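{- For all $w_1,w_2\in\mathfrak{h}^1$, $\Psi(w_1)*_-\Psi(w_2)=\Psi(w_1\,\overline{*}\,w_2)$.
   Context: Let $\hbar$ be an indeterminate and $\mathcal{C}=\mathbb{Q}[\hbar]$. Let $\mathfrak{h}^1$ be the non-commutative polynomial algebra over $\mathcal{C}$ freely generated by letters $z_1,z_2,\dots$; juxtaposition is concatenation, words are monomials $z_{k_1}\cdots z_{k_r}$ ($r\ge0$, empty word $1$). Products on letters: $z_i\circ z_j=z_{i+j}$, $z_i\circ_\pm z_j=\pm z_{i+j}+\hbar z_{i+j-1}$; actions on $\mathfrak{h}^1$: $z_i\circ1=0$, $z_i\circ(z_jw)=(z_i\circ z_j)w$, and the same for $\circ_\pm$, extended $\mathcal{C}$-bilinearly. The $\mathcal{C}$-bilinear product $*_-$: $1*_-w=w*_-1=w$, $(z_iw_1)*_-(z_jw_2)=z_i(w_1*_-z_jw_2)+z_j(z_iw_1*_-w_2)+(z_i\circ_-z_j)(w_1*_-w_2)$. The $\mathcal{C}$-bilinear product $\overline{*}$: $1\,\overline{*}\,w=w\,\overline{*}\,1=w$, $(z_iw_1)\,\overline{*}\,(z_jw_2)=z_i(w_1\,\overline{*}\,z_jw_2)+z_j(z_iw_1\,\overline{*}\,w_2)-z_{i+j}(w_1\,\overline{*}\,w_2)$. The $\mathcal{C}$-linear maps $d,d_q$: $d(1)=d_q(1)=1$, $d(z_iw)=z_i\,d(w)+z_i\circ d(w)$, $d_q(z_iw)=z_i\,d_q(w)+z_i\circ_+d_q(w)$; $d_q$ is bijective.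 The $\mathcal{C}$-linear map $\phi$: for a word $u=z_{k_1}\cdots z_{k_r}$ of weight $K=\sum k_i$, let $I_u=\{k_1+\dots+k_j:1\le j<r\}$ and $\{1,\dots,K\}\setminus I_u=\{p_1<\dots<p_l\}$; then $\phi(u)=z_{p_1}z_{p_2-p_1}\cdots z_{p_l-p_{l-1}}$, $\phi(1)=1$. $\Psi=\phi\circ d_q^{ -1}\circ d\circ\phi$. -}

module Defs where

open import Data.Nat as ℕ using (ℕ; zero; suc; _∸_)
open import Data.Bool using (Bool; true; false; if_then_else_; not)
open import Data.List using (List; []; _∷_; _++_; map; concatMap; foldr; filter; upTo; any)
open import Data.List.Properties using (≡-dec)
open import Data.Product using (_×_; _,_)
open import Data.Rational as ℚ using (ℚ; 0ℚ; 1ℚ; -_)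
open import Relation.Nullary.Decidable using (⌊_⌋; _×-dec_)
open import Relation.Binary.PropositionalEquality using (_≡_)

-- Convention: the letter z_k (k ≥ 1) is encoded by the natural
-- number k ∸ 1, i.e. the code a : ℕ stands for z_(suc a).
-- A word z_{k1} ⋯ z_{kr} is the list of codes (k1 ∸ 1) ∷ ⋯ ∷ (kr ∸ 1).

Word : Set
Word = List ℕ

-- Elements of 𝔥¹ = 𝒞⟨z₁,z₂,…⟩ with 𝒞 = ℚ[ħ]: finite formal sums of
-- terms q · ħ^j · w  (q ∈ ℚ, j ∈ ℕ, w a word).
Term : Set
Term = ℚ × ℕ × Word

H : Set
H = List Term

coeff : H → ℕ → Word → ℚ
coeff [] j w = 0ℚ
coeff ((q , i , v) ∷ x) j w =
  if ⌊ (i ℕ.≟ j) ×-dec (≡-dec ℕ._≟_ v w) ⌋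
  then q ℚ.+ coeff x j w else coeff x j w

infix 4 _≈_
_≈_ : H → H → Set
x ≈ y = ∀ (j : ℕ) (w : Word) → coeff x j w ≡ coeff y j w

𝟙 : H
𝟙 = (1ℚ , 0 , []) ∷ []

word : Word → H
word w = (1ℚ , 0 , w) ∷ []

scale : ℚ → ℕ → H → H
scale q j = map (λ { (q' , j' , w) → (q ℚ.* q' , j ℕ.+ j' , w) })

neg : H → H
neg = scale (- 1ℚ) 0

ħ· : H → H
ħ· = scale 1ℚ 1

z· : ℕ → H → H
z· a = map (λ { (q , j , w) → (q , j , a ∷ w) })

lin : (Word → H) → H → H
lin f = concatMap (λ { (q , j , w) → scale q j (f w) })

bilin : (Word → Word → H) → H → H → H
bilin f x y = lin (λ u → lin (λ v → f u v) y) x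

-- The actions z_i ∘ — and z_i ∘₊ — on words (code a = letter z_(suc a)).
-- z_(a+1) ∘ z_(k+1) = z_(a+k+2)  (code suc (a + k));
-- z_(a+1) ∘₊ z_(k+1) = z_(a+k+2) + ħ z_(a+k+1)  (codes suc (a+k), a+k).

circ : ℕ → Word → H
circ a [] = []
circ a (k ∷ w) = word (suc (a ℕ.+ k) ∷ w)

circ₊ : ℕ → Word → H
circ₊ a [] = []
circ₊ a (k ∷ w) = word (suc (a ℕ.+ k) ∷ w) ++ ħ· (word (a ℕ.+ k ∷ w))

star₋w : Word → Word → H
star₋w [] v = word v
star₋w (i ∷ u) [] = word (i ∷ u)
star₋w (i ∷ u) (j ∷ v) =
  z· i (star₋w u (j ∷ v)) ++ z· j (star₋w (i ∷ u) v)
  -- (z_i ∘₋ z_j) = - z_(i+j) + ħ z_(i+j-1)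
  ++ (neg (z· (suc (i ℕ.+ j)) (star₋w u v)) ++ ħ· (z· (i ℕ.+ j) (star₋w u v)))

starbarw : Word → Word → H
starbarw [] v = word v
starbarw (i ∷ u) [] = word (i ∷ u)
starbarw (i ∷ u) (j ∷ v) =
  z· i (starbarw u (j ∷ v)) ++ z· j (starbarw (i ∷ u) v)
  ++ neg (z· (suc (i ℕ.+ j)) (starbarw u v))

infixl 7 _*₋_ _⊛_
_*₋_ : H → H → H
_*₋_ = bilin star₋w

_⊛_ : H → H → H
_⊛_ = bilin starbarw

dw : Word → H
dw [] = 𝟙
dw (i ∷ w) = z· i (dw w) ++ lin (circ i) (dw w)

dqw : Word → H
dqw [] = 𝟙
dqw (i ∷ w) = z· i (dqw w) ++ lin (circ₊ i) (dqw w)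

d : H → H
d = lin dw

dq : H → H
dq = lin dqw

-- weights k_j of the letters (k_j = suc code)
-- partial sums k1, k1+k2, …, k1+⋯+k_(r-1)  (j < r)
partials : ℕ → Word → List ℕ
partials s [] = []
partials s (k ∷ []) = []
partials s (k ∷ k' ∷ w) = (s ℕ.+ suc k) ∷ partials (s ℕ.+ suc k) (k' ∷ w)

weight : Word → ℕ
weight = foldr (λ k s → suc k ℕ.+ s) 0

Iset : Word → List ℕ
Iset = partials 0

complementI : Word → List ℕ
complementI u =
  filter (λ p → Relation.Nullary.Decidable.¬? (Data.List.Membership.DecPropositional._∈?_ ℕ._≟_ p (Iset u)))
         (map suc (upTo (weight u)))
  where import Data.List.Membership.DecPropositional
        import Relation.Nullary.Decidable

-- p₁ < ⋯ < p_l  ↦  z_(p₁) z_(p₂-p₁) ⋯ z_(p_l - p_(l-1))   (codes p_i - p_(i-1) - 1)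
diffs : ℕ → List ℕ → Word
diffs prev [] = []
diffs prev (p ∷ ps) = (p ∸ suc prev) ∷ diffs p ps

φw : Word → Word
φw u = diffs 0 (complementI u)

φ : H → H
φ = lin (λ u → word (φw u))

Ψ : (H → H) → H → H
Ψ dqinv x = φ (dqinv (d (φ x)))

module Submission where

-- Idea: Ψ has an explicit description.  Put ℓ_0 = z₁, ℓ_{c+1} = z₁ ∘ ℓ_c − ħ ℓ_c
-- (combinations of one-letter words) and define the linear map σ by
--   σ(1) = 1,   σ(z_{c+1} v) = ℓ_c ▷ σ(v),
-- where ℓ ▷ X replaces each letter z_a of ℓ by the word z_a X.  Then
--  (1) Ψ = σ.  From φ(z_{c+1} v) = z₁^c A(φ v) (A raises the first letter) one
--      gets φ ∘ φ = id and d ∘ φ = d_q ∘ φ ∘ σ; an explicit left inverse of d_q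
--      then identifies d_q⁻¹ ∘ d ∘ φ with φ ∘ σ.
--  (2) σ(x) *₋ σ(y) = σ(x ⊛ y).  Both products follow the same recursion on
--      first letters, and the correction terms match since ℓ_i ∘₋ ℓ_j = −ℓ_{i+j+1}.

open import Defs
open import Data.Nat as ℕ using (ℕ; zero; suc)
import Data.Nat.Properties as ℕP
open import Data.Bool using (if_then_else_)
open import Data.List using (List; []; _∷_; _++_; map; length; replicate; filter; upTo; applyUpTo)
import Data.List.Properties as LP
open import Data.List.Properties using (≡-dec)
open import Data.List.Membership.Propositional using (_∈_)
import Data.List.Membership.Propositional.Properties as MP
open import Data.List.Membership.DecPropositional ℕ._≟_ using (_∈?_)
open import Data.List.Relation.Unary.Any using (here; there)
open import Data.List.Relation.Unary.All as All using (All; []; _∷_)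
open import Data.Product using (_×_; _,_; proj₁; proj₂)
open import Data.Rational as ℚ using (ℚ; 0ℚ; 1ℚ; -_)
import Data.Rational.Properties as ℚP
open import Data.Empty using (⊥-elim)
open import Relation.Nullary using (¬_; yes; no; Dec)
open import Relation.Nullary.Decidable using (⌊_⌋; _×-dec_; ¬?)
import Relation.Unary as RU
open import Relation.Binary.PropositionalEquality
open import Relation.Binary.Bundles using (Setoid)
import Relation.Binary.Reasoning.Setoid as SetoidReasoning
open import Algebra.Bundles using (CommutativeRing)
open CommutativeRing ℚP.+-*-commutativeRing using (+-commutativeSemigroup; +-group; ring)
open import Algebra.Properties.CommutativeSemigroup +-commutativeSemigroup using (interchange)
open import Algebra.Properties.Group +-group using (x∙y⁻¹≈ε⇒x≈y)
open import Algebra.Properties.Ring ring using (-1*x≈-x)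

sameKey? : (i : ℕ) (v : Word) (j : ℕ) (w : Word) → Dec (i ≡ j × v ≡ w)
sameKey? i v j w = (i ℕ.≟ j) ×-dec (≡-dec ℕ._≟_ v w)

termCoeff : Term → ℕ → Word → ℚ
termCoeff (q , i , v) j w = if ⌊ sameKey? i v j w ⌋ then q else 0ℚ

coeff-cons : ∀ t x j w → coeff (t ∷ x) j w ≡ termCoeff t j w ℚ.+ coeff x j w
coeff-cons (q , i , v) x j w with sameKey? i v j w
... | yes _ = refl
... | no _ = sym (ℚP.+-identityˡ _)

termCoeff-miss : ∀ q i v j w → ¬ (i ≡ j × v ≡ w) → termCoeff (q , i , v) j w ≡ 0ℚ
termCoeff-miss q i v j w ne with sameKey? i v j w
... | yes p = ⊥-elim (ne p)
... | no _ = refl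

-- Coefficient equality x ≈ y, wrapped in a record: the bare function type
-- x ≈ y does not determine x and y, which defeats inference in reasoning chains.
infix 4 _≋_
record _≋_ (x y : H) : Set where
  constructor mk
  field get : x ≈ y
open _≋_

≋-refl : ∀ {x} → x ≋ x
≋-refl = mk λ _ _ → refl

≋-sym : ∀ {x y} → x ≋ y → y ≋ x
≋-sym (mk p) = mk λ j w → sym (p j w)

≋-trans : ∀ {x y z} → x ≋ y → y ≋ z → x ≋ z
≋-trans (mk p) (mk q) = mk λ j w → trans (p j w) (q j w)

≡⇒≋ : ∀ {x y} → x ≡ y → x ≋ y
≡⇒≋ refl = ≋-refl

≋-setoid : Setoid _ _
≋-setoid = record
  { Carrier = H ; _≈_ = _≋_
  ; isEquivalence = record { refl = ≋-refl ; sym = ≋-sym ; trans = ≋-trans } }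

module ≋-Reasoning = SetoidReasoning ≋-setoid

-- Addition in 𝔥¹ is concatenation of term lists.
coeff-++ : ∀ x y j w → coeff (x ++ y) j w ≡ coeff x j w ℚ.+ coeff y j w
coeff-++ [] y j w = sym (ℚP.+-identityˡ _)
coeff-++ (t ∷ x) y j w = begin
  coeff (t ∷ x ++ y) j w                              ≡⟨ coeff-cons t (x ++ y) j w ⟩
  termCoeff t j w ℚ.+ coeff (x ++ y) j w              ≡⟨ cong (termCoeff t j w ℚ.+_) (coeff-++ x y j w) ⟩
  termCoeff t j w ℚ.+ (coeff x j w ℚ.+ coeff y j w)   ≡⟨ sym (ℚP.+-assoc (termCoeff t j w) _ _) ⟩
  (termCoeff t j w ℚ.+ coeff x j w) ℚ.+ coeff y j w   ≡⟨ cong (ℚ._+ coeff y j w) (sym (coeff-cons t x j w)) ⟩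
  coeff (t ∷ x) j w ℚ.+ coeff y j w                   ∎
  where open ≡-Reasoning

++-cong : ∀ {x x' y y'} → x ≋ x' → y ≋ y' → x ++ y ≋ x' ++ y'
++-cong {x} {x'} {y} {y'} (mk p) (mk q) = mk λ j w →
  trans (coeff-++ x y j w) (trans (cong₂ ℚ._+_ (p j w) (q j w)) (sym (coeff-++ x' y' j w)))

++-congˡ : ∀ {x x'} y → x ≋ x' → x ++ y ≋ x' ++ y
++-congˡ y p = ++-cong p ≋-refl

++-congʳ : ∀ x {y y'} → y ≋ y' → x ++ y ≋ x ++ y'
++-congʳ x p = ++-cong ≋-refl p

++-comm : ∀ x y → x ++ y ≋ y ++ x
++-comm x y = mk λ j w →
  trans (coeff-++ x y j w) (trans (ℚP.+-comm (coeff x j w) _) (sym (coeff-++ y x j w)))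

++-assoc : ∀ x y z → (x ++ y) ++ z ≋ x ++ (y ++ z)
++-assoc x y z = ≡⇒≋ (LP.++-assoc x y z)

++-identityʳ : ∀ x → x ++ [] ≋ x
++-identityʳ x = ≡⇒≋ (LP.++-identityʳ x)

++-swap : ∀ a b c → a ++ (b ++ c) ≋ b ++ (a ++ c)
++-swap a b c = ≋-trans (≋-sym (++-assoc a b c)) (≋-trans (++-congˡ c (++-comm a b)) (++-assoc b a c))

++-interchange : ∀ a b c e → (a ++ b) ++ (c ++ e) ≋ (a ++ c) ++ (b ++ e)
++-interchange a b c e = mk λ j w → begin
  coeff ((a ++ b) ++ (c ++ e)) j w
    ≡⟨ trans (coeff-++ (a ++ b) (c ++ e) j w) (cong₂ ℚ._+_ (coeff-++ a b j w) (coeff-++ c e j w)) ⟩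
  (coeff a j w ℚ.+ coeff b j w) ℚ.+ (coeff c j w ℚ.+ coeff e j w)
    ≡⟨ interchange (coeff a j w) (coeff b j w) (coeff c j w) (coeff e j w) ⟩
  (coeff a j w ℚ.+ coeff c j w) ℚ.+ (coeff b j w ℚ.+ coeff e j w)
    ≡⟨ sym (trans (coeff-++ (a ++ c) (b ++ e) j w) (cong₂ ℚ._+_ (coeff-++ a c j w) (coeff-++ b e j w))) ⟩
  coeff ((a ++ c) ++ (b ++ e)) j w ∎
  where open ≡-Reasoning

scale-scale : ∀ q i q' i' X → scale q i (scale q' i' X) ≡ scale (q ℚ.* q') (i ℕ.+ i') X
scale-scale q i q' i' [] = refl
scale-scale q i q' i' ((a , k , v) ∷ X) =
  cong₂ _∷_ (cong₂ _,_ (sym (ℚP.*-assoc q q' a)) (cong (_, v) (sym (ℕP.+-assoc i i' k))))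
            (scale-scale q i q' i' X)

scale-one : ∀ X → scale 1ℚ 0 X ≡ X
scale-one [] = refl
scale-one ((a , k , v) ∷ X) = cong₂ _∷_ (cong (_, k , v) (ℚP.*-identityˡ a)) (scale-one X)

scale-++ : ∀ q i x y → scale q i (x ++ y) ≡ scale q i x ++ scale q i y
scale-++ q i x y = LP.map-++ _ x y

coeff-scale₀ : ∀ q X j w → coeff (scale q 0 X) j w ≡ q ℚ.* coeff X j w
coeff-scale₀ q [] j w = sym (ℚP.*-zeroʳ q)
coeff-scale₀ q ((a , k , v) ∷ X) j w with sameKey? k v j w
... | yes _ = trans (cong (q ℚ.* a ℚ.+_) (coeff-scale₀ q X j w)) (sym (ℚP.*-distribˡ-+ q a (coeff X j w)))
... | no _ = coeff-scale₀ q X j w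

coeff-neg : ∀ X j w → coeff (neg X) j w ≡ - coeff X j w
coeff-neg X j w = trans (coeff-scale₀ (- 1ℚ) X j w) (-1*x≈-x (coeff X j w))

neg-inv : ∀ x → x ++ neg x ≋ []
neg-inv x = mk λ j w →
  trans (coeff-++ x (neg x) j w) (trans (cong (coeff x j w ℚ.+_) (coeff-neg x j w)) (ℚP.+-inverseʳ (coeff x j w)))

neg-neg : ∀ x → neg (neg x) ≡ x
neg-neg x = trans (scale-scale (- 1ℚ) 0 (- 1ℚ) 0 x) (scale-one x)

neg-ħ : ∀ x → neg (ħ· x) ≡ ħ· (neg x)
neg-ħ x = trans (scale-scale (- 1ℚ) 0 1ℚ 1 x)
  (trans (cong (λ c → scale c 1 x) (trans (ℚP.*-identityʳ (- 1ℚ)) (sym (ℚP.*-identityˡ (- 1ℚ)))))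
         (sym (scale-scale 1ℚ 1 (- 1ℚ) 0 x)))

terms-merge : ∀ p p' k v → (p , k , v) ∷ (p' , k , v) ∷ [] ≋ (p ℚ.+ p' , k , v) ∷ []
terms-merge p p' k v = mk λ j w → go j w
  where
  go : ∀ j w → coeff ((p , k , v) ∷ (p' , k , v) ∷ []) j w ≡ coeff ((p ℚ.+ p' , k , v) ∷ []) j w
  go j w with sameKey? k v j w
  ... | yes _ = trans (cong (p ℚ.+_) (ℚP.+-identityʳ p')) (sym (ℚP.+-identityʳ (p ℚ.+ p')))
  ... | no _ = refl

scale-add : ∀ q q' i X → scale q i X ++ scale q' i X ≋ scale (q ℚ.+ q') i X
scale-add q q' i [] = ≋-refl
scale-add q q' i ((a , k , v) ∷ X) =
  ≋-trans (++-interchange ((q ℚ.* a , i ℕ.+ k , v) ∷ []) (scale q i X) ((q' ℚ.* a , i ℕ.+ k , v) ∷ []) (scale q' i X))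
    (++-cong (≋-trans (terms-merge (q ℚ.* a) (q' ℚ.* a) (i ℕ.+ k) v)
                      (≡⇒≋ (cong (λ c → (c , i ℕ.+ k , v) ∷ []) (sym (ℚP.*-distribʳ-+ a q q')))))
             (scale-add q q' i X))

scale-zero : ∀ i X → scale 0ℚ i X ≋ []
scale-zero i X = mk (go X)
  where
  go : ∀ X j w → coeff (scale 0ℚ i X) j w ≡ 0ℚ
  go [] j w = refl
  go ((a , k , v) ∷ X) j w with sameKey? (i ℕ.+ k) v j w
  ... | yes _ = trans (cong₂ ℚ._+_ (ℚP.*-zeroˡ a) (go X j w)) (ℚP.+-identityˡ 0ℚ)
  ... | no _ = go X j w

-- Since `lin f` acts on
-- representatives, this needs an argument: removing all terms with one key
-- splits off their total coefficient (lin-split), so by induction on length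
-- `lin f` kills every representative of zero (lin-zero), and lin-cong follows
-- by linearity applied to x − y.

lin-++ : ∀ f x y → lin f (x ++ y) ≡ lin f x ++ lin f y
lin-++ f [] y = refl
lin-++ f ((q , j , v) ∷ x) y =
  trans (cong (scale q j (f v) ++_) (lin-++ f x y)) (sym (LP.++-assoc (scale q j (f v)) (lin f x) (lin f y)))

lin-scale : ∀ f q i x → lin f (scale q i x) ≡ scale q i (lin f x)
lin-scale f q i [] = refl
lin-scale f q i ((a , k , v) ∷ x) = begin
  scale (q ℚ.* a) (i ℕ.+ k) (f v) ++ lin f (scale q i x)
    ≡⟨ cong₂ _++_ (sym (scale-scale q i a k (f v))) (lin-scale f q i x) ⟩
  scale q i (scale a k (f v)) ++ scale q i (lin f x)
    ≡⟨ sym (scale-++ q i (scale a k (f v)) (lin f x)) ⟩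
  scale q i (scale a k (f v) ++ lin f x) ∎
  where open ≡-Reasoning

removeKey : ℕ → Word → H → H
removeKey i v [] = []
removeKey i v ((q , i' , v') ∷ y) with sameKey? i' v' i v
... | yes _ = removeKey i v y
... | no _ = (q , i' , v') ∷ removeKey i v y

removeKey-length : ∀ i v y → length (removeKey i v y) ℕ.≤ length y
removeKey-length i v [] = ℕ.z≤n
removeKey-length i v ((q , i' , v') ∷ y) with sameKey? i' v' i v
... | yes _ = ℕP.m≤n⇒m≤1+n (removeKey-length i v y)
... | no _ = ℕ.s≤s (removeKey-length i v y)

removeKey-shrinks : ∀ q i v y → length (removeKey i v ((q , i , v) ∷ y)) ℕ.≤ length y
removeKey-shrinks q i v y with sameKey? i v i v
... | yes _ = removeKey-length i v y
... | no ne = ⊥-elim (ne (refl , refl))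

removeKey-hit : ∀ i v y → coeff (removeKey i v y) i v ≡ 0ℚ
removeKey-hit i v [] = refl
removeKey-hit i v ((q , i' , v') ∷ y) with sameKey? i' v' i v
... | yes _ = removeKey-hit i v y
... | no ne = trans (coeff-cons (q , i' , v') (removeKey i v y) i v)
                (trans (cong₂ ℚ._+_ (termCoeff-miss q i' v' i v ne) (removeKey-hit i v y)) (ℚP.+-identityˡ 0ℚ))

removeKey-miss : ∀ i v y j w → ¬ (i ≡ j × v ≡ w) → coeff (removeKey i v y) j w ≡ coeff y j w
removeKey-miss i v [] j w ne = refl
removeKey-miss i v ((q , i' , v') ∷ y) j w ne with sameKey? i' v' i v
... | yes (refl , refl) = begin
  coeff (removeKey i v y) j w               ≡⟨ removeKey-miss i v y j w ne ⟩
  coeff y j w                               ≡⟨ sym (ℚP.+-identityˡ (coeff y j w)) ⟩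
  0ℚ ℚ.+ coeff y j w                         ≡⟨ cong (ℚ._+ coeff y j w) (sym (termCoeff-miss q i v j w ne)) ⟩
  termCoeff (q , i , v) j w ℚ.+ coeff y j w  ≡⟨ sym (coeff-cons (q , i , v) y j w) ⟩
  coeff ((q , i , v) ∷ y) j w               ∎
  where open ≡-Reasoning
... | no _ = trans (coeff-cons (q , i' , v') (removeKey i v y) j w)
               (trans (cong (termCoeff (q , i' , v') j w ℚ.+_) (removeKey-miss i v y j w ne))
                      (sym (coeff-cons (q , i' , v') y j w)))

lin-split : ∀ f i v y → lin f y ≋ scale (coeff y i v) i (f v) ++ lin f (removeKey i v y)
lin-split f i v [] = ≋-sym (≋-trans (++-identityʳ _) (scale-zero i (f v)))
lin-split f i v ((q , i' , v') ∷ y) with sameKey? i' v' i v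
... | yes (refl , refl) =
  ≋-trans (++-congʳ (scale q i (f v)) (lin-split f i v y))
    (≋-trans (≋-sym (++-assoc (scale q i (f v)) (scale (coeff y i v) i (f v)) (lin f (removeKey i v y))))
             (++-congˡ (lin f (removeKey i v y)) (scale-add q (coeff y i v) i (f v))))
... | no _ =
  ≋-trans (++-congʳ (scale q i' (f v')) (lin-split f i v y))
          (++-swap (scale q i' (f v')) (scale (coeff y i v) i (f v)) (lin f (removeKey i v y)))

IsZero : H → Set
IsZero x = ∀ j w → coeff x j w ≡ 0ℚ

lin-zero-bounded : ∀ f n x → length x ℕ.≤ n → IsZero x → lin f x ≋ []
lin-zero-bounded f n [] _ _ = ≋-refl
lin-zero-bounded f (suc n) x@((q , i , v) ∷ x') (ℕ.s≤s len) x≈0 =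
  ≋-trans (lin-split f i v x)
    (++-cong (≋-trans (≡⇒≋ (cong (λ c → scale c i (f v)) (x≈0 i v))) (scale-zero i (f v)))
             (lin-zero-bounded f n (removeKey i v x) (ℕP.≤-trans (removeKey-shrinks q i v x') len) rest≈0))
  where
  rest≈0 : IsZero (removeKey i v x)
  rest≈0 j w with sameKey? i v j w
  ... | yes (refl , refl) = removeKey-hit i v x
  ... | no ne = trans (removeKey-miss i v x j w ne) (x≈0 j w)

lin-zero : ∀ f x → IsZero x → lin f x ≋ []
lin-zero f x = lin-zero-bounded f (length x) x ℕP.≤-refl

lin-cong : ∀ f {x y} → x ≋ y → lin f x ≋ lin f y
lin-cong f {x} {y} (mk x≈y) = mk λ j w → x∙y⁻¹≈ε⇒x≈y (coeff (lin f x) j w) (coeff (lin f y) j w) (difference≈0 j w)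
  where
  x-y≈0 : IsZero (x ++ neg y)
  x-y≈0 j w = trans (coeff-++ x (neg y) j w)
    (trans (cong₂ ℚ._+_ (x≈y j w) (coeff-neg y j w)) (ℚP.+-inverseʳ (coeff y j w)))
  difference≈0 : ∀ j w → coeff (lin f x) j w ℚ.+ - coeff (lin f y) j w ≡ 0ℚ
  difference≈0 j w = begin
    coeff (lin f x) j w ℚ.+ - coeff (lin f y) j w
      ≡⟨ cong (coeff (lin f x) j w ℚ.+_) (sym (coeff-neg (lin f y) j w)) ⟩
    coeff (lin f x) j w ℚ.+ coeff (neg (lin f y)) j w
      ≡⟨ sym (coeff-++ (lin f x) (neg (lin f y)) j w) ⟩
    coeff (lin f x ++ neg (lin f y)) j w
      ≡⟨ cong (λ z → coeff (lin f x ++ z) j w) (sym (lin-scale f (- 1ℚ) 0 y)) ⟩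
    coeff (lin f x ++ lin f (neg y)) j w
      ≡⟨ cong (λ z → coeff z j w) (sym (lin-++ f x (neg y))) ⟩
    coeff (lin f (x ++ neg y)) j w
      ≡⟨ get (lin-zero f (x ++ neg y) x-y≈0) j w ⟩
    0ℚ ∎
    where open ≡-Reasoning

lin-word : ∀ f v → lin f (word v) ≡ f v
lin-word f v = trans (LP.++-identityʳ (scale 1ℚ 0 (f v))) (scale-one (f v))

lin-word-id : ∀ x → lin word x ≡ x
lin-word-id [] = refl
lin-word-id ((q , k , v) ∷ x) =
  cong₂ _∷_ (cong₂ _,_ (ℚP.*-identityʳ q) (cong (_, v) (ℕP.+-identityʳ k))) (lin-word-id x)

lin-ext : ∀ {f g} → (∀ v → f v ≡ g v) → ∀ x → lin f x ≡ lin g x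
lin-ext f≡g [] = refl
lin-ext f≡g ((q , j , v) ∷ x) = cong₂ _++_ (cong (scale q j) (f≡g v)) (lin-ext f≡g x)

lin-comp : ∀ f g x → lin f (lin g x) ≡ lin (λ v → lin f (g v)) x
lin-comp f g [] = refl
lin-comp f g ((q , j , v) ∷ x) =
  trans (lin-++ f (scale q j (g v)) (lin g x)) (cong₂ _++_ (lin-scale f q j (g v)) (lin-comp f g x))

lin-nil : ∀ x → lin (λ _ → []) x ≡ []
lin-nil [] = refl
lin-nil (_ ∷ x) = lin-nil x

-- Scaling and prefixing a letter are themselves linear extensions, hence respect ≋.
scale-as-lin : ∀ q i x → scale q i x ≡ lin (λ v → scale q i (word v)) x
scale-as-lin q i [] = refl
scale-as-lin q i ((a , k , v) ∷ x) = cong₂ _∷_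
  (cong₂ _,_ (trans (ℚP.*-comm q a) (cong (a ℚ.*_) (sym (ℚP.*-identityʳ q))))
             (cong (_, v) (trans (ℕP.+-comm i k) (cong (k ℕ.+_) (sym (ℕP.+-identityʳ i))))))
  (scale-as-lin q i x)

z·-as-lin : ∀ a x → z· a x ≡ lin (λ v → word (a ∷ v)) x
z·-as-lin a [] = refl
z·-as-lin a ((q , k , v) ∷ x) =
  cong₂ _∷_ (cong₂ _,_ (sym (ℚP.*-identityʳ q)) (cong (_, a ∷ v) (sym (ℕP.+-identityʳ k)))) (z·-as-lin a x)

scale-cong : ∀ q i {x y} → x ≋ y → scale q i x ≋ scale q i y
scale-cong q i {x} {y} p = ≋-trans (≡⇒≋ (scale-as-lin q i x))
  (≋-trans (lin-cong (λ v → scale q i (word v)) p) (≡⇒≋ (sym (scale-as-lin q i y))))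

z·-cong : ∀ a {x y} → x ≋ y → z· a x ≋ z· a y
z·-cong a {x} {y} p = ≋-trans (≡⇒≋ (z·-as-lin a x))
  (≋-trans (lin-cong (λ v → word (a ∷ v)) p) (≡⇒≋ (sym (z·-as-lin a y))))

neg-cong : ∀ {x y} → x ≋ y → neg x ≋ neg y
neg-cong = scale-cong (- 1ℚ) 0

ħ-cong : ∀ {x y} → x ≋ y → ħ· x ≋ ħ· y
ħ-cong = scale-cong 1ℚ 1

lin-fcong : ∀ {f g} → (∀ v → f v ≋ g v) → ∀ x → lin f x ≋ lin g x
lin-fcong p [] = ≋-refl
lin-fcong p ((q , j , v) ∷ x) = ++-cong (scale-cong q j (p v)) (lin-fcong p x)

lin-sum : ∀ f g x → lin (λ v → f v ++ g v) x ≋ lin f x ++ lin g x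
lin-sum f g [] = ≋-refl
lin-sum f g ((q , j , v) ∷ x) =
  ≋-trans (++-cong (≡⇒≋ (scale-++ q j (f v) (g v))) (lin-sum f g x))
          (++-interchange (scale q j (f v)) (scale q j (g v)) (lin f x) (lin g x))

lin-scaleF : ∀ f q i x → lin (λ v → scale q i (f v)) x ≡ scale q i (lin f x)
lin-scaleF f q i [] = refl
lin-scaleF f q i ((a , k , v) ∷ x) = begin
  scale a k (scale q i (f v)) ++ lin (λ v → scale q i (f v)) x
    ≡⟨ cong₂ _++_ scales-commute (lin-scaleF f q i x) ⟩
  scale q i (scale a k (f v)) ++ scale q i (lin f x)
    ≡⟨ sym (scale-++ q i (scale a k (f v)) (lin f x)) ⟩
  scale q i (scale a k (f v) ++ lin f x) ∎
  where
  open ≡-Reasoning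
  scales-commute : scale a k (scale q i (f v)) ≡ scale q i (scale a k (f v))
  scales-commute = trans (scale-scale a k q i (f v))
    (trans (cong₂ (λ c n → scale c n (f v)) (ℚP.*-comm a q) (ℕP.+-comm k i)) (sym (scale-scale q i a k (f v))))

z·-scale : ∀ b q i Y → z· b (scale q i Y) ≡ scale q i (z· b Y)
z·-scale b q i [] = refl
z·-scale b q i (t ∷ Y) = cong (_ ∷_) (z·-scale b q i Y)

z·-++ : ∀ b x y → z· b (x ++ y) ≡ z· b x ++ z· b y
z·-++ b x y = LP.map-++ _ x y

lin-z·F : ∀ f b x → lin (λ v → z· b (f v)) x ≡ z· b (lin f x)
lin-z·F f b [] = refl
lin-z·F f b ((a , k , v) ∷ x) =
  trans (cong₂ _++_ (sym (z·-scale b a k (f v))) (lin-z·F f b x)) (sym (z·-++ b (scale a k (f v)) (lin f x)))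

lin-z· : ∀ f a x → lin f (z· a x) ≡ lin (λ v → f (a ∷ v)) x
lin-z· f a [] = refl
lin-z· f a ((q , k , v) ∷ x) = cong (scale q k (f (a ∷ v)) ++_) (lin-z· f a x)

lin-ħ : ∀ f x → lin f (ħ· x) ≡ ħ· (lin f x)
lin-ħ f = lin-scale f 1ℚ 1

lin-neg : ∀ f x → lin f (neg x) ≡ neg (lin f x)
lin-neg f = lin-scale f (- 1ℚ) 0

neg-++ : ∀ x y → neg (x ++ y) ≡ neg x ++ neg y
neg-++ = scale-++ (- 1ℚ) 0

ħ-++ : ∀ x y → ħ· (x ++ y) ≡ ħ· x ++ ħ· y
ħ-++ = scale-++ 1ℚ 1

lin-swap : ∀ (F : Word → Word → H) x y → lin (λ u → lin (F u) y) x ≋ lin (λ v → lin (λ u → F u v) x) y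
lin-swap F [] y = ≡⇒≋ (sym (lin-nil y))
lin-swap F ((q , j , u) ∷ x) y = ≋-sym (≋-trans (lin-sum (λ v → scale q j (F u v)) (λ v → lin (λ u → F u v) x) y)
   (++-cong (≡⇒≋ (lin-scaleF (F u) q j y)) (≋-sym (lin-swap F x y))))

-- The combinatorics of φ.  Writing A for "raise the first letter by one"
-- (A(1) = z₁), the key identity is φ(z_{c+1} v) = z₁^c A(φ v) (φ-cons):
-- the complement set of z_{c+1} v starts with 1, …, c and continues with the
-- complement set of v shifted by c + 1.  It implies that φ is an involution.

raise : Word → Word
raise [] = 0 ∷ []
raise (a ∷ u) = suc a ∷ u

interval : ℕ → ℕ → List ℕ
interval s zero = []
interval s (suc n) = suc s ∷ interval (suc s) n

applyUpTo-interval : ∀ s n f → (∀ i → f i ≡ suc (s ℕ.+ i)) → applyUpTo f n ≡ interval s n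
applyUpTo-interval s zero f f≗ = refl
applyUpTo-interval s (suc n) f f≗ =
  cong₂ _∷_ (trans (f≗ 0) (cong suc (ℕP.+-identityʳ s)))
            (applyUpTo-interval (suc s) n (λ i → f (suc i)) (λ i → trans (f≗ (suc i)) (cong suc (ℕP.+-suc s i))))

upTo-interval : ∀ n → map suc (upTo n) ≡ interval 0 n
upTo-interval n = trans (LP.map-upTo suc n) (applyUpTo-interval 0 n suc (λ _ → refl))

interval-++ : ∀ s a b → interval s (a ℕ.+ b) ≡ interval s a ++ interval (s ℕ.+ a) b
interval-++ s zero b = cong (λ t → interval t b) (sym (ℕP.+-identityʳ s))
interval-++ s (suc a) b = cong (suc s ∷_)
  (trans (interval-++ (suc s) a b) (cong (λ t → interval (suc s) a ++ interval t b) (sym (ℕP.+-suc s a))))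

interval-shift : ∀ s t n → interval (s ℕ.+ t) n ≡ map (s ℕ.+_) (interval t n)
interval-shift s t zero = refl
interval-shift s t (suc n) = cong₂ _∷_ (sym (ℕP.+-suc s t))
  (trans (cong (λ z → interval z n) (sym (ℕP.+-suc s t))) (interval-shift s (suc t) n))

interval-bounds : ∀ s n p → p ∈ interval s n → s ℕ.< p × p ℕ.≤ s ℕ.+ n
interval-bounds s (suc n) p (here refl) =
  ℕP.≤-refl , subst (suc s ℕ.≤_) (sym (ℕP.+-suc s n)) (ℕ.s≤s (ℕP.m≤m+n s n))
interval-bounds s (suc n) p (there p∈) with interval-bounds (suc s) n p p∈
... | lower , upper = ℕP.<-trans (ℕP.n<1+n s) lower , subst (p ℕ.≤_) (sym (ℕP.+-suc s n)) upper

interval-last : ∀ n → suc n ∈ interval 0 (suc n)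
interval-last n = subst (suc n ∈_) (trans (sym (interval-++ 0 n 1)) (cong (interval 0) (ℕP.+-comm n 1)))
  (MP.∈-++⁺ʳ (interval 0 n) (here refl))

interval-split : ∀ c W → interval 0 (suc c ℕ.+ W) ≡ interval 0 c ++ (suc c ∷ map (suc c ℕ.+_) (interval 0 W))
interval-split c W = trans (cong (interval 0) (sym (ℕP.+-suc c W)))
  (trans (interval-++ 0 c (suc W))
         (cong (λ z → interval 0 c ++ (suc c ∷ z))
               (trans (cong (λ t → interval t W) (sym (ℕP.+-identityʳ (suc c)))) (interval-shift (suc c) 0 W))))

diffs-interval : ∀ s n ys → diffs s (interval s n ++ ys) ≡ replicate n 0 ++ diffs (s ℕ.+ n) ys
diffs-interval s zero ys = cong (λ t → diffs t ys) (sym (ℕP.+-identityʳ s))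
diffs-interval s (suc n) ys = cong₂ _∷_ (ℕP.n∸n≡0 (suc s))
  (trans (diffs-interval (suc s) n ys) (cong (λ t → replicate n 0 ++ diffs t ys) (sym (ℕP.+-suc s n))))

diffs-shift : ∀ t p ps → diffs (t ℕ.+ p) (map (t ℕ.+_) ps) ≡ diffs p ps
diffs-shift t p [] = refl
diffs-shift t p (q ∷ ps) = cong₂ _∷_
  (trans (cong ((t ℕ.+ q) ℕ.∸_) (sym (ℕP.+-suc t p))) (ℕP.[m+n]∸[m+o]≡n∸o t q (suc p)))
  (diffs-shift t q ps)

-- Shifting a set of positive positions by c + 1 raises the first gap by c
-- relative to the base point c; measured from 0, this is `raise`.
diffs-shift-raise : ∀ c C → (∀ x → x ∈ C → 1 ℕ.≤ x) → ∀ y → y ∈ C →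
                    diffs c (map (suc c ℕ.+_) C) ≡ raise (diffs 0 C)
diffs-shift-raise c (zero ∷ ps) pos y y∈ = ⊥-elim (ℕP.<-irrefl refl (pos 0 (here refl)))
diffs-shift-raise c (suc p ∷ ps) pos y y∈ =
  cong₂ _∷_ (ℕP.m+n∸m≡n (suc c) (suc p)) (diffs-shift (suc c) (suc p) ps)

filter-map : ∀ {P Q : ℕ → Set} (P? : RU.Decidable P) (Q? : RU.Decidable Q) (f : ℕ → ℕ) xs →
  (∀ x → x ∈ xs → (P (f x) → Q x) × (Q x → P (f x))) → filter P? (map f xs) ≡ map f (filter Q? xs)
filter-map P? Q? f [] P⇔Q = refl
filter-map P? Q? f (x ∷ xs) P⇔Q with P? (f x) | Q? x
... | yes p | yes q = cong (f x ∷_) (filter-map P? Q? f xs (λ y m → P⇔Q y (there m)))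
... | yes p | no ¬q = ⊥-elim (¬q (proj₁ (P⇔Q x (here refl)) p))
... | no ¬p | yes q = ⊥-elim (¬p (proj₂ (P⇔Q x (here refl)) q))
... | no ¬p | no ¬q = filter-map P? Q? f xs (λ y m → P⇔Q y (there m))

partials-shift : ∀ s w → partials s w ≡ map (s ℕ.+_) (partials 0 w)
partials-shift s [] = refl
partials-shift s (k ∷ []) = refl
partials-shift s (k ∷ k' ∷ w) = cong (s ℕ.+ suc k ∷_) (begin
    partials (s ℕ.+ suc k) (k' ∷ w)
      ≡⟨ partials-shift (s ℕ.+ suc k) (k' ∷ w) ⟩
    map ((s ℕ.+ suc k) ℕ.+_) (partials 0 (k' ∷ w))
      ≡⟨ LP.map-cong (ℕP.+-assoc s (suc k)) (partials 0 (k' ∷ w)) ⟩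
    map (λ x → s ℕ.+ (suc k ℕ.+ x)) (partials 0 (k' ∷ w))
      ≡⟨ LP.map-∘ (partials 0 (k' ∷ w)) ⟩
    map (s ℕ.+_) (map (suc k ℕ.+_) (partials 0 (k' ∷ w)))
      ≡⟨ cong (map (s ℕ.+_)) (sym (partials-shift (suc k) (k' ∷ w))) ⟩
    map (s ℕ.+_) (partials (suc k) (k' ∷ w)) ∎)
  where open ≡-Reasoning

partials-bound : ∀ s w x → x ∈ partials s w → x ℕ.< s ℕ.+ weight w
partials-bound s (k ∷ k' ∷ w) x (here refl) = ℕP.+-monoʳ-< s (ℕP.m<m+n (suc k) (ℕ.s≤s ℕ.z≤n))
partials-bound s (k ∷ k' ∷ w) x (there x∈) =
  subst (x ℕ.<_) (ℕP.+-assoc s (suc k) (weight (k' ∷ w))) (partials-bound (s ℕ.+ suc k) (k' ∷ w) x x∈)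

Iset-cons : ∀ c k w → Iset (c ∷ k ∷ w) ≡ suc c ∷ map (suc c ℕ.+_) (Iset (k ∷ w))
Iset-cons c k w = cong (suc c ∷_) (partials-shift (suc c) (k ∷ w))

NotInI : Word → ℕ → Set
NotInI u p = ¬ (p ∈ Iset u)

NotInI? : ∀ u → RU.Decidable (NotInI u)
NotInI? u p = ¬? (p ∈? Iset u)

complement-def : ∀ u → complementI u ≡ filter (NotInI? u) (interval 0 (weight u))
complement-def u = cong (filter (NotInI? u)) (upTo-interval (weight u))

-- The positions 1, …, c lie before the first partial sum c + 1.
below-first-notInI : ∀ c k w x → x ∈ interval 0 c → NotInI (c ∷ k ∷ w) x
below-first-notInI c k w x x∈ x∈I with subst (x ∈_) (Iset-cons c k w) x∈I
... | here refl = ℕP.<-irrefl refl (proj₂ (interval-bounds 0 c x x∈))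
... | there x∈shifted with MP.∈-map⁻ (suc c ℕ.+_) x∈shifted
... | y , _ , refl = ℕP.<-irrefl refl (ℕP.≤-trans (proj₂ (interval-bounds 0 c x x∈)) (ℕP.m≤m+n c y))

-- Beyond c + 1, the partial sums of z_{c+1} z_{k+1} w are those of z_{k+1} w shifted by c + 1.
shifted-notInI : ∀ c k w x → x ∈ interval 0 (weight (k ∷ w)) →
                 (NotInI (c ∷ k ∷ w) (suc c ℕ.+ x) → NotInI (k ∷ w) x) × (NotInI (k ∷ w) x → NotInI (c ∷ k ∷ w) (suc c ℕ.+ x))
shifted-notInI c k w x x∈ =
    (λ ∉I x∈I → ∉I (subst (suc c ℕ.+ x ∈_) (sym (Iset-cons c k w)) (there (MP.∈-map⁺ (suc c ℕ.+_) x∈I))))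
  , (λ ∉I x∈I → ∉I (unshift (subst (suc c ℕ.+ x ∈_) (Iset-cons c k w) x∈I)))
  where
  unshift : suc c ℕ.+ x ∈ (suc c ∷ map (suc c ℕ.+_) (Iset (k ∷ w))) → x ∈ Iset (k ∷ w)
  unshift (here e) = ⊥-elim (ℕP.<-irrefl (sym (ℕP.+-cancelˡ-≡ (suc c) x 0 (trans e (sym (ℕP.+-identityʳ (suc c))))))
                                         (proj₁ (interval-bounds 0 (weight (k ∷ w)) x x∈)))
  unshift (there y∈) with MP.∈-map⁻ (suc c ℕ.+_) y∈
  ... | y , y∈I , e = subst (_∈ Iset (k ∷ w)) (sym (ℕP.+-cancelˡ-≡ (suc c) x y e)) y∈I

complement-cons : ∀ c k w → complementI (c ∷ k ∷ w) ≡ interval 0 c ++ map (suc c ℕ.+_) (complementI (k ∷ w))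
complement-cons c k w = begin
  complementI (c ∷ k ∷ w)
    ≡⟨ trans (complement-def (c ∷ k ∷ w)) (cong (filter P?) (interval-split c W)) ⟩
  filter P? (interval 0 c ++ (suc c ∷ map (suc c ℕ.+_) (interval 0 W)))
    ≡⟨ LP.filter-++ P? (interval 0 c) _ ⟩
  filter P? (interval 0 c) ++ filter P? (suc c ∷ map (suc c ℕ.+_) (interval 0 W))
    ≡⟨ cong₂ _++_ (LP.filter-all P? (All.tabulate (λ {x} → below-first-notInI c k w x)))
                  (LP.filter-reject P? (λ ∉I → ∉I (subst (suc c ∈_) (sym (Iset-cons c k w)) (here refl)))) ⟩
  interval 0 c ++ filter P? (map (suc c ℕ.+_) (interval 0 W))
    ≡⟨ cong (interval 0 c ++_) (filter-map P? (NotInI? (k ∷ w)) (suc c ℕ.+_) (interval 0 W) (shifted-notInI c k w)) ⟩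
  interval 0 c ++ map (suc c ℕ.+_) (filter (NotInI? (k ∷ w)) (interval 0 W))
    ≡⟨ cong (λ C → interval 0 c ++ map (suc c ℕ.+_) C) (sym (complement-def (k ∷ w))) ⟩
  interval 0 c ++ map (suc c ℕ.+_) (complementI (k ∷ w)) ∎
  where
  open ≡-Reasoning
  W = weight (k ∷ w)
  P? = NotInI? (c ∷ k ∷ w)

complement-positive : ∀ u x → x ∈ complementI u → 1 ℕ.≤ x
complement-positive u x x∈ =
  proj₁ (interval-bounds 0 (weight u) x (proj₁ (MP.∈-filter⁻ (NotInI? u) (subst (x ∈_) (complement-def u) x∈))))

weight-∈-complement : ∀ k w → weight (k ∷ w) ∈ complementI (k ∷ w)
weight-∈-complement k w = subst (weight (k ∷ w) ∈_) (sym (complement-def (k ∷ w)))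
  (MP.∈-filter⁺ (NotInI? (k ∷ w)) (interval-last (k ℕ.+ weight w))
                (λ W∈I → ℕP.<-irrefl refl (partials-bound 0 (k ∷ w) (weight (k ∷ w)) W∈I)))

φ-cons : ∀ c v → φw (c ∷ v) ≡ replicate c 0 ++ raise (φw v)
φ-cons c [] = begin
  diffs 0 (complementI (c ∷ []))
    ≡⟨ cong (diffs 0) (trans (complement-def (c ∷ [])) (LP.filter-all (NotInI? (c ∷ [])) (All.tabulate (λ _ ())))) ⟩
  diffs 0 (interval 0 (suc c ℕ.+ 0))
    ≡⟨ cong (λ n → diffs 0 (interval 0 n)) (trans (ℕP.+-identityʳ (suc c)) (ℕP.+-comm 1 c)) ⟩
  diffs 0 (interval 0 (c ℕ.+ 1))
    ≡⟨ cong (diffs 0) (interval-++ 0 c 1) ⟩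
  diffs 0 (interval 0 c ++ interval c 1)
    ≡⟨ diffs-interval 0 c (interval c 1) ⟩
  replicate c 0 ++ (suc c ℕ.∸ suc c) ∷ []
    ≡⟨ cong (λ z → replicate c 0 ++ z ∷ []) (ℕP.n∸n≡0 (suc c)) ⟩
  replicate c 0 ++ 0 ∷ [] ∎
  where open ≡-Reasoning
φ-cons c (k ∷ w) = begin
  diffs 0 (complementI (c ∷ k ∷ w))
    ≡⟨ cong (diffs 0) (complement-cons c k w) ⟩
  diffs 0 (interval 0 c ++ map (suc c ℕ.+_) C)
    ≡⟨ diffs-interval 0 c _ ⟩
  replicate c 0 ++ diffs c (map (suc c ℕ.+_) C)
    ≡⟨ cong (replicate c 0 ++_)
            (diffs-shift-raise c C (complement-positive (k ∷ w)) (weight (k ∷ w)) (weight-∈-complement k w)) ⟩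
  replicate c 0 ++ raise (diffs 0 C) ∎
  where
  open ≡-Reasoning
  C = complementI (k ∷ w)

raise^ : ℕ → Word → Word
raise^ zero u = u
raise^ (suc n) u = raise (raise^ n u)

φ-z₁^ : ∀ c y → φw (replicate c 0 ++ y) ≡ raise^ c (φw y)
φ-z₁^ zero y = refl
φ-z₁^ (suc c) y = trans (φ-cons 0 (replicate c 0 ++ y)) (cong raise (φ-z₁^ c y))

φ-raise : ∀ v → φw (raise v) ≡ 0 ∷ φw v
φ-raise [] = φ-cons 0 []
φ-raise (a ∷ u) = trans (φ-cons (suc a) u) (cong (0 ∷_) (sym (φ-cons a u)))

raise^-z₁ : ∀ c t → raise^ c (0 ∷ t) ≡ c ∷ t
raise^-z₁ zero t = refl
raise^-z₁ (suc c) t = cong raise (raise^-z₁ c t)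

φw-involutive : ∀ u → φw (φw u) ≡ u
φw-involutive [] = refl
φw-involutive (c ∷ v) = begin
  φw (φw (c ∷ v))                 ≡⟨ cong φw (φ-cons c v) ⟩
  φw (replicate c 0 ++ raise (φw v)) ≡⟨ φ-z₁^ c (raise (φw v)) ⟩
  raise^ c (φw (raise (φw v)))    ≡⟨ cong (raise^ c) (φ-raise (φw v)) ⟩
  raise^ c (0 ∷ φw (φw v))        ≡⟨ raise^-z₁ c (φw (φw v)) ⟩
  c ∷ φw (φw v)                   ≡⟨ cong (c ∷_) (φw-involutive v) ⟩
  c ∷ v                           ∎
  where open ≡-Reasoning

φ-involutive : ∀ x → φ (φ x) ≡ x
φ-involutive x = trans (lin-comp (λ u → word (φw u)) (λ u → word (φw u)) x)
  (trans (lin-ext (λ u → trans (lin-word (λ u → word (φw u)) (φw u)) (cong word (φw-involutive u))) x)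
         (lin-word-id x))

-- d and d_q on words z₁^c A(y).  Prefixing z₁ acts on d and d_q through
--   T x = z₁ x + z₁ ∘ x   and   T₊ x = z₁ x + z₁ ∘₊ x,
-- and raising the first letter commutes with d and d_q.  On elements without
-- the empty word, z₁ ∘₊ = z₁ ∘ + ħ, so T₊ = T + ħ there.

-- z₁ ∘ —, i.e. raise the first letter of each nonempty word (and kill 1).
z₁∘ : H → H
z₁∘ = lin (circ 0)

T : H → H
T x = z· 0 x ++ z₁∘ x

T₊ : H → H
T₊ x = z· 0 x ++ lin (circ₊ 0) x

T^ : ℕ → H → H
T^ zero x = x
T^ (suc n) x = T (T^ n x)

T₊^ : ℕ → H → H
T₊^ zero x = x
T₊^ (suc n) x = T₊ (T₊^ n x)

raiseH : H → H
raiseH = lin (λ u → word (raise u))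

T^-cong : ∀ n {x y} → x ≋ y → T^ n x ≋ T^ n y
T^-cong zero p = p
T^-cong (suc n) p = T-cong (T^-cong n p)
  where T-cong : ∀ {x y} → x ≋ y → T x ≋ T y
        T-cong p = ++-cong (z·-cong 0 p) (lin-cong (circ 0) p)

T₊-cong : ∀ {x y} → x ≋ y → T₊ x ≋ T₊ y
T₊-cong p = ++-cong (z·-cong 0 p) (lin-cong (circ₊ 0) p)

T₊^-cong : ∀ n {x y} → x ≋ y → T₊^ n x ≋ T₊^ n y
T₊^-cong zero p = p
T₊^-cong (suc n) p = T₊-cong (T₊^-cong n p)

T₊-lin : ∀ g X → T₊ (lin g X) ≋ lin (λ v → T₊ (g v)) X
T₊-lin g X = ≋-sym (≋-trans (lin-sum (λ v → z· 0 (g v)) (λ v → lin (circ₊ 0) (g v)) X)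
   (≡⇒≋ (cong₂ _++_ (lin-z·F g 0 X) (sym (lin-comp (circ₊ 0) g X)))))

T₊^-lin : ∀ n g X → T₊^ n (lin g X) ≋ lin (λ v → T₊^ n (g v)) X
T₊^-lin zero g X = ≋-refl
T₊^-lin (suc n) g X = ≋-trans (T₊-cong (T₊^-lin n g X)) (T₊-lin (λ v → T₊^ n (g v)) X)

dw-z₁^ : ∀ c y → dw (replicate c 0 ++ y) ≡ T^ c (dw y)
dw-z₁^ zero y = refl
dw-z₁^ (suc c) y = cong T (dw-z₁^ c y)

dqw-z₁^ : ∀ c y → dqw (replicate c 0 ++ y) ≡ T₊^ c (dqw y)
dqw-z₁^ zero y = refl
dqw-z₁^ (suc c) y = cong T₊ (dqw-z₁^ c y)

-- Raising the first letter of z_a Y + z_a ⋆ Y, for any family of actions ⋆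
-- (given as act a v = z_a ⋆ v) compatible with raising: A(z_a ⋆ v) = z_{a+1} ⋆ v.
raise-step : (act : ℕ → Word → H) → (∀ a v → raiseH (act a v) ≋ act (suc a) v) →
             ∀ a Y → raiseH (z· a Y ++ lin (act a) Y) ≋ z· (suc a) Y ++ lin (act (suc a)) Y
raise-step act raise-act a Y =
  ≋-trans (≡⇒≋ (lin-++ (λ u → word (raise u)) (z· a Y) (lin (act a) Y)))
    (++-cong (≡⇒≋ (trans (lin-z· (λ u → word (raise u)) a Y) (sym (z·-as-lin (suc a) Y))))
             (≋-trans (≡⇒≋ (lin-comp (λ u → word (raise u)) (act a) Y)) (lin-fcong (raise-act a) Y)))

raise-circ : ∀ a v → raiseH (circ a v) ≋ circ (suc a) v
raise-circ a [] = ≋-refl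
raise-circ a (k ∷ w) = ≡⇒≋ (lin-word (λ u → word (raise u)) (suc (a ℕ.+ k) ∷ w))

raise-circ₊ : ∀ a v → raiseH (circ₊ a v) ≋ circ₊ (suc a) v
raise-circ₊ a [] = ≋-refl
raise-circ₊ a (k ∷ w) = ≡⇒≋ (trans (lin-++ R (word (suc (a ℕ.+ k) ∷ w)) (ħ· (word (a ℕ.+ k ∷ w))))
  (cong₂ _++_ (lin-word R (suc (a ℕ.+ k) ∷ w)) (trans (lin-ħ R (word (a ℕ.+ k ∷ w))) (cong ħ· (lin-word R (a ℕ.+ k ∷ w))))))
  where R = λ u → word (raise u)

dw-raise : ∀ v → dw (raise v) ≋ raiseH (dw v)
dw-raise [] = ≋-refl
dw-raise (a ∷ u) = ≋-sym (raise-step circ raise-circ a (dw u))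

dqw-raise : ∀ v → dqw (raise v) ≋ raiseH (dqw v)
dqw-raise [] = ≋-refl
dqw-raise (a ∷ u) = ≋-sym (raise-step circ₊ raise-circ₊ a (dqw u))

NoEmptyWord : H → Set
NoEmptyWord = All (λ t → proj₂ (proj₂ t) ≢ [])

noEmpty-++ : ∀ {x y} → NoEmptyWord x → NoEmptyWord y → NoEmptyWord (x ++ y)
noEmpty-++ [] ny = ny
noEmpty-++ (p ∷ nx) ny = p ∷ noEmpty-++ nx ny

noEmpty-scale : ∀ q i {x} → NoEmptyWord x → NoEmptyWord (scale q i x)
noEmpty-scale q i [] = []
noEmpty-scale q i (p ∷ nx) = p ∷ noEmpty-scale q i nx

noEmpty-z· : ∀ a x → NoEmptyWord (z· a x)
noEmpty-z· a [] = []
noEmpty-z· a (_ ∷ x) = (λ ()) ∷ noEmpty-z· a x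

noEmpty-lin : ∀ f → (∀ v → NoEmptyWord (f v)) → ∀ x → NoEmptyWord (lin f x)
noEmpty-lin f nf [] = []
noEmpty-lin f nf ((q , j , v) ∷ x) = noEmpty-++ (noEmpty-scale q j (nf v)) (noEmpty-lin f nf x)

noEmpty-T^ : ∀ n x → NoEmptyWord x → NoEmptyWord (T^ n x)
noEmpty-T^ zero x nx = nx
noEmpty-T^ (suc n) x nx = noEmpty-++ (noEmpty-z· 0 (T^ n x)) (noEmpty-lin (circ 0) circ-noEmpty (T^ n x))
  where circ-noEmpty : ∀ v → NoEmptyWord (circ 0 v)
        circ-noEmpty [] = []
        circ-noEmpty (k ∷ w) = (λ ()) ∷ []

noEmpty-raiseH : ∀ x → NoEmptyWord (raiseH x)
noEmpty-raiseH = noEmpty-lin _ raise-noEmpty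
  where raise-noEmpty : ∀ v → NoEmptyWord (word (raise v))
        raise-noEmpty [] = (λ ()) ∷ []
        raise-noEmpty (k ∷ w) = (λ ()) ∷ []

lin-fcong-noEmpty : ∀ {f g} → (∀ v → v ≢ [] → f v ≋ g v) → ∀ {x} → NoEmptyWord x → lin f x ≋ lin g x
lin-fcong-noEmpty p {[]} [] = ≋-refl
lin-fcong-noEmpty p {(q , j , v) ∷ x} (v≢[] ∷ nx) = ++-cong (scale-cong q j (p v v≢[])) (lin-fcong-noEmpty p nx)

-- z₁ ∘₊ v = z₁ ∘ v + ħ v for nonempty v, hence T₊ = T + ħ away from the empty word.
T₊≋T+ħ : ∀ {Z} → NoEmptyWord Z → T₊ Z ≋ T Z ++ ħ· Z
T₊≋T+ħ {Z} nZ = ≋-trans (++-congʳ (z· 0 Z) (≋-trans (lin-fcong-noEmpty circ₊≋circ+ħ nZ)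
                 (≋-trans (lin-sum (circ 0) (λ v → ħ· (word v)) Z) (++-congʳ (z₁∘ Z) (≡⇒≋ ħ-as-lin)))))
               (≋-sym (++-assoc (z· 0 Z) (z₁∘ Z) (ħ· Z)))
  where
  circ₊≋circ+ħ : ∀ v → v ≢ [] → circ₊ 0 v ≋ circ 0 v ++ ħ· (word v)
  circ₊≋circ+ħ [] v≢[] = ⊥-elim (v≢[] refl)
  circ₊≋circ+ħ (k ∷ w) _ = ≋-refl
  ħ-as-lin : lin (λ v → ħ· (word v)) Z ≡ ħ· Z
  ħ-as-lin = trans (lin-scaleF word 1ℚ 1 Z) (cong ħ· (lin-word-id Z))

-- An explicit left inverse of d_q:
--   e(1) = 1,  e(z_c w) = z_c e(w) − z_c ∘₊ e(w).
-- The key point is that e commutes with z_c ∘₊ — (dq⁻¹-circ₊), which rests on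
-- the associativity-type rule z_c ∘₊ (z_k ∘₊ v) = z_{c+k+2} ∘₊ v + ħ z_{c+k+1} ∘₊ v.

dq⁻¹w : Word → H
dq⁻¹w [] = 𝟙
dq⁻¹w (c ∷ w) = z· c (dq⁻¹w w) ++ neg (lin (circ₊ c) (dq⁻¹w w))

dq⁻¹ : H → H
dq⁻¹ = lin dq⁻¹w

lin-circ₊-z· : ∀ c k X → lin (circ₊ c) (z· k X) ≋ z· (suc (c ℕ.+ k)) X ++ ħ· (z· (c ℕ.+ k) X)
lin-circ₊-z· c k X = ≋-trans (≡⇒≋ (lin-z· (circ₊ c) k X))
  (≋-trans (lin-sum (λ v → word (suc (c ℕ.+ k) ∷ v)) (λ v → ħ· (word (c ℕ.+ k ∷ v))) X)
    (≡⇒≋ (cong₂ _++_ (sym (z·-as-lin (suc (c ℕ.+ k)) X))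
      (trans (lin-scaleF (λ v → word (c ℕ.+ k ∷ v)) 1ℚ 1 X) (cong ħ· (sym (z·-as-lin (c ℕ.+ k) X)))))))

circ₊-circ₊ : ∀ c k v → lin (circ₊ c) (circ₊ k v) ≡ circ₊ (suc (c ℕ.+ k)) v ++ ħ· (circ₊ (c ℕ.+ k) v)
circ₊-circ₊ c k [] = refl
circ₊-circ₊ c k (m ∷ w) = begin
  lin (circ₊ c) (word (suc (k ℕ.+ m) ∷ w) ++ ħ· (word (k ℕ.+ m ∷ w)))
    ≡⟨ lin-++ (circ₊ c) (word (suc (k ℕ.+ m) ∷ w)) (ħ· (word (k ℕ.+ m ∷ w))) ⟩
  lin (circ₊ c) (word (suc (k ℕ.+ m) ∷ w)) ++ lin (circ₊ c) (ħ· (word (k ℕ.+ m ∷ w)))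
    ≡⟨ cong₂ _++_ (lin-word (circ₊ c) (suc (k ℕ.+ m) ∷ w))
                  (trans (lin-ħ (circ₊ c) (word (k ℕ.+ m ∷ w))) (cong ħ· (lin-word (circ₊ c) (k ℕ.+ m ∷ w)))) ⟩
  circ₊ c (suc (k ℕ.+ m) ∷ w) ++ ħ· (circ₊ c (k ℕ.+ m ∷ w))
    ≡⟨ cong₂ (λ a b → (word (suc a ∷ w) ++ ħ· (word (a ∷ w))) ++ ħ· (word (suc b ∷ w) ++ ħ· (word (b ∷ w))))
             (trans (ℕP.+-suc c (k ℕ.+ m)) (cong suc (sym (ℕP.+-assoc c k m)))) (sym (ℕP.+-assoc c k m)) ⟩
  circ₊ (suc (c ℕ.+ k)) (m ∷ w) ++ ħ· (circ₊ (c ℕ.+ k) (m ∷ w)) ∎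
  where open ≡-Reasoning

regroup : ∀ a b c e → (a ++ neg b) ++ ħ· (c ++ neg e) ≋ (a ++ ħ· c) ++ neg (b ++ ħ· e)
regroup a b c e =
  ≋-trans (≡⇒≋ (cong ((a ++ neg b) ++_) (trans (ħ-++ c (neg e)) (cong (ħ· c ++_) (sym (neg-ħ e))))))
    (≋-trans (++-interchange a (neg b) (ħ· c) (neg (ħ· e)))
             (≡⇒≋ (cong ((a ++ ħ· c) ++_) (sym (neg-++ b (ħ· e))))))

dq⁻¹-circ₊ : ∀ c u → dq⁻¹ (circ₊ c u) ≋ lin (circ₊ c) (dq⁻¹w u)
dq⁻¹-circ₊ c [] = ≋-refl
dq⁻¹-circ₊ c (k ∷ w) = begin
  dq⁻¹ (word (s ∷ w) ++ ħ· (word (t ∷ w)))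
    ≡⟨ trans (lin-++ dq⁻¹w (word (s ∷ w)) (ħ· (word (t ∷ w))))
         (cong₂ _++_ (lin-word dq⁻¹w (s ∷ w)) (trans (lin-ħ dq⁻¹w (word (t ∷ w))) (cong ħ· (lin-word dq⁻¹w (t ∷ w))))) ⟩
  (z· s X ++ neg (lin (circ₊ s) X)) ++ ħ· (z· t X ++ neg (lin (circ₊ t) X))
    ≈⟨ regroup (z· s X) (lin (circ₊ s) X) (z· t X) (lin (circ₊ t) X) ⟩
  (z· s X ++ ħ· (z· t X)) ++ neg (lin (circ₊ s) X ++ ħ· (lin (circ₊ t) X))
    ≈⟨ ++-cong (≋-sym (lin-circ₊-z· c k X)) (neg-cong (≋-sym circ₊-twice)) ⟩
  lin (circ₊ c) (z· k X) ++ neg (lin (circ₊ c) (lin (circ₊ k) X))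
    ≡⟨ sym (trans (lin-++ (circ₊ c) (z· k X) (neg (lin (circ₊ k) X)))
                  (cong (lin (circ₊ c) (z· k X) ++_) (lin-neg (circ₊ c) (lin (circ₊ k) X)))) ⟩
  lin (circ₊ c) (dq⁻¹w (k ∷ w)) ∎
  where
  open ≋-Reasoning
  X = dq⁻¹w w
  s = suc (c ℕ.+ k)
  t = c ℕ.+ k
  circ₊-twice : lin (circ₊ c) (lin (circ₊ k) X) ≋ lin (circ₊ s) X ++ ħ· (lin (circ₊ t) X)
  circ₊-twice = ≋-trans (≡⇒≋ (trans (lin-comp (circ₊ c) (circ₊ k) X) (lin-ext (circ₊-circ₊ c k) X)))
    (≋-trans (lin-sum (circ₊ s) (λ v → ħ· (circ₊ t v)) X) (≡⇒≋ (cong (lin (circ₊ s) X ++_) (lin-scaleF (circ₊ t) 1ℚ 1 X))))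

dq⁻¹-z· : ∀ c Y → dq⁻¹ (z· c Y) ≋ z· c (dq⁻¹ Y) ++ neg (lin (circ₊ c) (dq⁻¹ Y))
dq⁻¹-z· c Y = ≋-trans (≡⇒≋ (lin-z· dq⁻¹w c Y))
  (≋-trans (lin-sum (λ u → z· c (dq⁻¹w u)) (λ u → neg (lin (circ₊ c) (dq⁻¹w u))) Y)
   (≡⇒≋ (cong₂ _++_ (lin-z·F dq⁻¹w c Y)
     (trans (lin-scaleF (λ u → lin (circ₊ c) (dq⁻¹w u)) (- 1ℚ) 0 Y) (cong neg (sym (lin-comp (circ₊ c) dq⁻¹w Y)))))))

-- e ∘ d_q = id on words: the correction −z_c ∘₊ e(·) cancels the term z_c ∘₊ of d_q.
dq⁻¹-dqw : ∀ w → dq⁻¹ (dqw w) ≋ word w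
dq⁻¹-dqw [] = ≋-refl
dq⁻¹-dqw (c ∷ w) = begin
  dq⁻¹ (z· c Y ++ lin (circ₊ c) Y)       ≡⟨ lin-++ dq⁻¹w (z· c Y) (lin (circ₊ c) Y) ⟩
  dq⁻¹ (z· c Y) ++ dq⁻¹ (lin (circ₊ c) Y) ≈⟨ ++-cong (dq⁻¹-z· c Y) commute ⟩
  (z· c (dq⁻¹ Y) ++ neg L) ++ L          ≈⟨ ++-assoc (z· c (dq⁻¹ Y)) (neg L) L ⟩
  z· c (dq⁻¹ Y) ++ (neg L ++ L)          ≈⟨ ++-congʳ (z· c (dq⁻¹ Y)) (≋-trans (++-comm (neg L) L) (neg-inv L)) ⟩
  z· c (dq⁻¹ Y) ++ []                    ≈⟨ ++-identityʳ _ ⟩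
  z· c (dq⁻¹ Y)                          ≈⟨ z·-cong c (dq⁻¹-dqw w) ⟩
  word (c ∷ w)                           ∎
  where
  open ≋-Reasoning
  Y = dqw w
  L = lin (circ₊ c) (dq⁻¹ Y)
  commute : dq⁻¹ (lin (circ₊ c) Y) ≋ L
  commute = ≋-trans (≡⇒≋ (lin-comp dq⁻¹w (circ₊ c) Y))
    (≋-trans (lin-fcong (dq⁻¹-circ₊ c) Y) (≡⇒≋ (sym (lin-comp (circ₊ c) dq⁻¹w Y))))

dq⁻¹-dq : ∀ x → dq⁻¹ (dq x) ≋ x
dq⁻¹-dq x = ≋-trans (≡⇒≋ (lin-comp dq⁻¹w dqw x)) (≋-trans (lin-fcong dq⁻¹-dqw x) (≡⇒≋ (lin-word-id x)))

-- The map σ with Ψ = σ.  Let ℓ_0 = z₁ and ℓ_{c+1} = z₁ ∘ ℓ_c − ħ ℓ_c, a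
-- combination of one-letter words, and let ℓ ▷ X replace each letter z_a of ℓ
-- by the word z_a X.  Then σ(1) = 1, σ(z_{c+1} v) = ℓ_c ▷ σ(v).
-- Under d_q ∘ φ, "ℓ ▷" becomes "actOn ℓ ∘ A", where a letter z_{a+1} acts by T₊^a;
-- actOn ℓ_c = (T₊ − ħ)^c = T^c on elements without the empty word, which matches
-- d(φ(z_{c+1} v)) = T^c A d(φ v).  Hence d ∘ φ = d_q ∘ φ ∘ σ.

ℓ : ℕ → H
ℓ zero = word (0 ∷ [])
ℓ (suc c) = z₁∘ (ℓ c) ++ neg (ħ· (ℓ c))

-- prefixBy X (z_a u) = z_a X, so that m ▷ X = Σ (coefficient) z_a X over the letters z_a of m.
prefixBy : H → Word → H
prefixBy X [] = []
prefixBy X (a ∷ _) = z· a X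

infixr 6 _▷_
_▷_ : H → H → H
m ▷ X = lin (prefixBy X) m

σw : Word → H
σw [] = 𝟙
σw (c ∷ v) = ℓ c ▷ σw v

σ : H → H
σ = lin σw

actBy : H → Word → H
actBy Y [] = []
actBy Y (a ∷ _) = T₊^ a Y

actOn : H → H → H
actOn m Y = lin (actBy Y) m

dqφw : Word → H
dqφw u = dqw (φw u)

dφw : Word → H
dφw v = dw (φw v)

dqφ-z· : ∀ a X → lin dqφw (z· a X) ≋ T₊^ a (raiseH (lin dqφw X))
dqφ-z· a X = ≋-trans (≡⇒≋ (lin-z· dqφw a X))
  (≋-trans (lin-fcong on-words X)
  (≋-trans (≋-sym (T₊^-lin a (λ v → raiseH (dqφw v)) X))
           (T₊^-cong a (≡⇒≋ (sym (lin-comp (λ u → word (raise u)) dqφw X))))))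
  where
  on-words : ∀ v → dqφw (a ∷ v) ≋ T₊^ a (raiseH (dqφw v))
  on-words v = ≋-trans (≡⇒≋ (trans (cong dqw (φ-cons a v)) (dqw-z₁^ a (raise (φw v)))))
                       (T₊^-cong a (dqw-raise (φw v)))

dqφ-▷ : ∀ m X → lin dqφw (m ▷ X) ≋ actOn m (raiseH (lin dqφw X))
dqφ-▷ m X = ≋-trans (≡⇒≋ (lin-comp dqφw (prefixBy X) m)) (lin-fcong on-words m)
  where on-words : ∀ u → lin dqφw (prefixBy X u) ≋ actBy (raiseH (lin dqφw X)) u
        on-words [] = ≋-refl
        on-words (a ∷ _) = dqφ-z· a X

actOn-z₁∘ : ∀ m Y → actOn (z₁∘ m) Y ≋ T₊ (actOn m Y)
actOn-z₁∘ m Y = ≋-trans (≡⇒≋ (lin-comp (actBy Y) (circ 0) m)) (≋-trans (lin-fcong on-words m) (≋-sym (T₊-lin (actBy Y) m)))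
  where on-words : ∀ u → actOn (circ 0 u) Y ≋ T₊ (actBy Y u)
        on-words [] = ≋-refl
        on-words (a ∷ w) = ≡⇒≋ (lin-word (actBy Y) (suc a ∷ w))

-- The defining recursion of ℓ turns T₊ into T₊ − ħ = T.
actOn-ℓ : ∀ c Y → NoEmptyWord Y → actOn (ℓ c) Y ≋ T^ c Y
actOn-ℓ zero Y _ = ≡⇒≋ (lin-word (actBy Y) (0 ∷ []))
actOn-ℓ (suc c) Y nY = begin
  actOn (z₁∘ (ℓ c) ++ neg (ħ· (ℓ c))) Y
    ≡⟨ trans (lin-++ (actBy Y) (z₁∘ (ℓ c)) (neg (ħ· (ℓ c))))
         (cong (actOn (z₁∘ (ℓ c)) Y ++_) (trans (lin-neg (actBy Y) (ħ· (ℓ c))) (cong neg (lin-ħ (actBy Y) (ℓ c))))) ⟩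
  actOn (z₁∘ (ℓ c)) Y ++ neg (ħ· (actOn (ℓ c) Y)) ≈⟨ ++-congˡ _ (actOn-z₁∘ (ℓ c) Y) ⟩
  T₊ (actOn (ℓ c) Y) ++ neg (ħ· (actOn (ℓ c) Y))  ≈⟨ ++-cong (T₊-cong IH) (neg-cong (ħ-cong IH)) ⟩
  T₊ Z ++ neg (ħ· Z)                             ≈⟨ ++-congˡ _ (T₊≋T+ħ (noEmpty-T^ c Y nY)) ⟩
  (T Z ++ ħ· Z) ++ neg (ħ· Z)                    ≈⟨ ++-assoc (T Z) (ħ· Z) (neg (ħ· Z)) ⟩
  T Z ++ (ħ· Z ++ neg (ħ· Z))                    ≈⟨ ++-congʳ (T Z) (neg-inv (ħ· Z)) ⟩
  T Z ++ []                                      ≈⟨ ++-identityʳ (T Z) ⟩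
  T Z                                            ∎
  where
  open ≋-Reasoning
  Z = T^ c Y
  IH = actOn-ℓ c Y nY

dφw-cons : ∀ c v → dφw (c ∷ v) ≋ T^ c (raiseH (dφw v))
dφw-cons c v = ≋-trans (≡⇒≋ (trans (cong dw (φ-cons c v)) (dw-z₁^ c (raise (φw v))))) (T^-cong c (dw-raise (φw v)))

dφw≋dqφσ : ∀ v → dφw v ≋ lin dqφw (σw v)
dφw≋dqφσ [] = ≋-refl
dφw≋dqφσ (c ∷ v) = begin
  dφw (c ∷ v)                               ≈⟨ dφw-cons c v ⟩
  T^ c (raiseH (dφw v))                     ≈⟨ T^-cong c (lin-cong (λ u → word (raise u)) (dφw≋dqφσ v)) ⟩
  T^ c (raiseH (lin dqφw (σw v)))           ≈⟨ ≋-sym (actOn-ℓ c _ (noEmpty-raiseH (lin dqφw (σw v)))) ⟩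
  actOn (ℓ c) (raiseH (lin dqφw (σw v)))    ≈⟨ ≋-sym (dqφ-▷ (ℓ c) (σw v)) ⟩
  lin dqφw (σw (c ∷ v))                     ∎
  where open ≋-Reasoning

dφ≋dqφσ : ∀ x → d (φ x) ≋ dq (φ (σ x))
dφ≋dqφσ x = begin
  lin dw (lin (λ u → word (φw u)) x)         ≡⟨ trans (lin-comp dw (λ u → word (φw u)) x) (lin-ext (λ u → lin-word dw (φw u)) x) ⟩
  lin dφw x                                  ≈⟨ lin-fcong dφw≋dqφσ x ⟩
  lin (λ u → lin dqφw (σw u)) x              ≡⟨ lin-ext (λ u → lin-ext (λ w → sym (lin-word dqw (φw w))) (σw u)) x ⟩
  lin (λ u → lin (λ w → dq (word (φw w))) (σw u)) x
    ≡⟨ lin-ext (λ u → sym (lin-comp dqw (λ w → word (φw w)) (σw u))) x ⟩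
  lin (λ u → dq (φ (σw u))) x                ≡⟨ sym (lin-comp dqw (λ u → φ (σw u)) x) ⟩
  dq (lin (λ u → φ (σw u)) x)                ≡⟨ cong dq (sym (lin-comp (λ u → word (φw u)) σw x)) ⟩
  dq (φ (σ x))                               ∎
  where open ≋-Reasoning

-- Any right inverse of d_q agrees with dq⁻¹, so Ψ = φ ∘ dq⁻¹ ∘ d ∘ φ = φ ∘ φ ∘ σ = σ.
Ψ≋σ : (dqinv : H → H) → (∀ x → dq (dqinv x) ≈ x) → ∀ x → Ψ dqinv x ≋ σ x
Ψ≋σ dqinv dq∘dqinv≈id x = begin
  φ (dqinv (d (φ x)))       ≈⟨ lin-cong (λ u → word (φw u)) (dqinv≋dq⁻¹ (d (φ x))) ⟩
  φ (dq⁻¹ (d (φ x)))        ≈⟨ lin-cong (λ u → word (φw u)) (lin-cong dq⁻¹w (dφ≋dqφσ x)) ⟩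
  φ (dq⁻¹ (dq (φ (σ x))))   ≈⟨ lin-cong (λ u → word (φw u)) (dq⁻¹-dq (φ (σ x))) ⟩
  φ (φ (σ x))               ≡⟨ φ-involutive (σ x) ⟩
  σ x                       ∎
  where
  open ≋-Reasoning
  dqinv≋dq⁻¹ : ∀ y → dqinv y ≋ dq⁻¹ y
  dqinv≋dq⁻¹ y = ≋-trans (≋-sym (dq⁻¹-dq (dqinv y))) (lin-cong dq⁻¹w {dq (dqinv y)} {y} (mk (dq∘dqinv≈id y)))

-- σ is a homomorphism from ⊛ to *₋.  Both products are defined by the same
-- recursion on first letters, so it suffices (▷-rule) to expand
-- (ℓ_i ▷ X) *₋ (ℓ_j ▷ Y) and to evaluate the correction term ℓ_i ∘₋ ℓ_j,
-- where ∘₋ is extended bilinearly to one-letter combinations: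
-- ℓ_i ∘₋ ℓ_j = −ℓ_{i+j+1} (ℓ-∘₋-ℓ), matching the term −z_{i+j+2} of z_{i+1} ⊛ z_{j+1}.

bilin-sum : ∀ f g X Y → bilin (λ x y → f x y ++ g x y) X Y ≋ bilin f X Y ++ bilin g X Y
bilin-sum f g X Y = ≋-trans (lin-fcong (λ x → lin-sum (f x) (g x) Y) X)
                            (lin-sum (λ x → lin (f x) Y) (λ x → lin (g x) Y) X)

bilin-z· : ∀ a f X Y → bilin (λ x y → z· a (f x y)) X Y ≡ z· a (bilin f X Y)
bilin-z· a f X Y = trans (lin-ext (λ x → lin-z·F (f x) a Y) X) (lin-z·F (λ x → lin (f x) Y) a X)

bilin-scale : ∀ q i f X Y → bilin (λ x y → scale q i (f x y)) X Y ≡ scale q i (bilin f X Y)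
bilin-scale q i f X Y = trans (lin-ext (λ x → lin-scaleF (f x) q i Y) X) (lin-scaleF (λ x → lin (f x) Y) q i X)

bilin-cong : ∀ f {x x' y y'} → x ≋ x' → y ≋ y' → bilin f x y ≋ bilin f x' y'
bilin-cong f {x} {x'} {y} {y'} p q = ≋-trans (lin-cong (λ u → lin (f u) y) p) (lin-fcong (λ u → lin-cong (f u) q) x')

letter∘₋ : ℕ → ℕ → H → H
letter∘₋ a b W = neg (z· (suc (a ℕ.+ b)) W) ++ ħ· (z· (a ℕ.+ b) W)

letter∘₋-by-sum : ∀ {a b a' b' W} → a ℕ.+ b ≡ a' ℕ.+ b' → letter∘₋ a b W ≡ letter∘₋ a' b' W
letter∘₋-by-sum {W = W} e = cong (λ k → neg (z· (suc k) W) ++ ħ· (z· k W)) e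

bilin-letter∘₋ : ∀ a b f X Y → bilin (λ x y → letter∘₋ a b (f x y)) X Y ≋ letter∘₋ a b (bilin f X Y)
bilin-letter∘₋ a b f X Y = ≋-trans (bilin-sum (λ x y → neg (z· (suc (a ℕ.+ b)) (f x y))) (λ x y → ħ· (z· (a ℕ.+ b) (f x y))) X Y)
  (≡⇒≋ (cong₂ _++_ (trans (bilin-scale (- 1ℚ) 0 (λ x y → z· (suc (a ℕ.+ b)) (f x y)) X Y) (cong neg (bilin-z· (suc (a ℕ.+ b)) f X Y)))
                   (trans (bilin-scale 1ℚ 1 (λ x y → z· (a ℕ.+ b) (f x y)) X Y) (cong ħ· (bilin-z· (a ℕ.+ b) f X Y)))))

*₋-linˡ : ∀ h m Z → lin h m *₋ Z ≡ lin (λ u → h u *₋ Z) m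
*₋-linˡ h m Z = lin-comp (λ u → lin (star₋w u) Z) h m

*₋-linʳ : ∀ h m Z → Z *₋ lin h m ≋ lin (λ v → Z *₋ h v) m
*₋-linʳ h m Z = ≋-trans (lin-fcong (λ u → ≡⇒≋ (lin-comp (star₋w u) h m)) Z) (lin-swap (λ u v → lin (star₋w u) (h v)) Z m)

*₋-z· : ∀ a b X Y → z· a X *₋ z· b Y ≋ z· a (X *₋ z· b Y) ++ (z· b (z· a X *₋ Y) ++ letter∘₋ a b (X *₋ Y))
*₋-z· a b X Y = begin
  z· a X *₋ z· b Y
    ≡⟨ trans (lin-z· (λ u → lin (star₋w u) (z· b Y)) a X) (lin-ext (λ x → lin-z· (star₋w (a ∷ x)) b Y) X) ⟩
  bilin (λ x y → star₋w (a ∷ x) (b ∷ y)) X Y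
    ≈⟨ ≋-trans (bilin-sum P₁ (λ x y → P₂ x y ++ letter∘₋ a b (star₋w x y)) X Y) (++-congʳ _ (bilin-sum P₂ _ X Y)) ⟩
  bilin P₁ X Y ++ (bilin P₂ X Y ++ bilin (λ x y → letter∘₋ a b (star₋w x y)) X Y)
    ≈⟨ ++-cong (≡⇒≋ (bilin-z· a (λ x y → star₋w x (b ∷ y)) X Y))
               (++-cong (≡⇒≋ (bilin-z· b (λ x y → star₋w (a ∷ x) y) X Y)) (bilin-letter∘₋ a b star₋w X Y)) ⟩
  z· a (bilin (λ x y → star₋w x (b ∷ y)) X Y) ++ (z· b (bilin (λ x y → star₋w (a ∷ x) y) X Y) ++ letter∘₋ a b (X *₋ Y))
    ≡⟨ cong₂ (λ L R → z· a L ++ (z· b R ++ letter∘₋ a b (X *₋ Y)))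
             (lin-ext (λ x → sym (lin-z· (star₋w x) b Y)) X) (sym (lin-z· (λ u → lin (star₋w u) Y) a X)) ⟩
  z· a (X *₋ z· b Y) ++ (z· b (z· a X *₋ Y) ++ letter∘₋ a b (X *₋ Y)) ∎
  where
  open ≋-Reasoning
  P₁ P₂ : Word → Word → H
  P₁ x y = z· a (star₋w x (b ∷ y))
  P₂ x y = z· b (star₋w (a ∷ x) y)

firstLetters∘₋ : Word → Word → H
firstLetters∘₋ (a ∷ _) (b ∷ _) = letter∘₋ a b 𝟙
firstLetters∘₋ _ _ = []

infixl 7 _∘₋_
_∘₋_ : H → H → H
_∘₋_ = bilin firstLetters∘₋

▷-cong : ∀ {m m' X X'} → m ≋ m' → X ≋ X' → m ▷ X ≋ m' ▷ X'
▷-cong {m} {m'} {X} {X'} p q = ≋-trans (lin-cong (prefixBy X) p) (lin-fcong on-words m')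
  where on-words : ∀ u → prefixBy X u ≋ prefixBy X' u
        on-words [] = ≋-refl
        on-words (a ∷ _) = z·-cong a q

▷-lin : ∀ m g S → m ▷ lin g S ≋ lin (λ w → m ▷ g w) S
▷-lin m g S = ≋-trans (lin-fcong on-words m) (lin-swap (λ u w → prefixBy (g w) u) m S)
  where on-words : ∀ u → prefixBy (lin g S) u ≋ lin (λ w → prefixBy (g w) u) S
        on-words [] = ≡⇒≋ (sym (lin-nil S))
        on-words (a ∷ _) = ≡⇒≋ (sym (lin-z·F g a S))

letter∘₋-▷ : ∀ a b Z → letter∘₋ a b 𝟙 ▷ Z ≡ letter∘₋ a b Z
letter∘₋-▷ a b Z = trans (lin-++ (prefixBy Z) (neg (word (suc (a ℕ.+ b) ∷ []))) (ħ· (word (a ℕ.+ b ∷ []))))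
  (cong₂ _++_ (trans (lin-neg (prefixBy Z) (word (suc (a ℕ.+ b) ∷ []))) (cong neg (lin-word (prefixBy Z) (suc (a ℕ.+ b) ∷ []))))
              (trans (lin-ħ (prefixBy Z) (word (a ℕ.+ b ∷ []))) (cong ħ· (lin-word (prefixBy Z) (a ℕ.+ b ∷ [])))))

▷-rule : ∀ m n X Y → (m ▷ X) *₋ (n ▷ Y) ≋ m ▷ (X *₋ (n ▷ Y)) ++ (n ▷ ((m ▷ X) *₋ Y) ++ (m ∘₋ n) ▷ (X *₋ Y))
▷-rule m n X Y = begin
  (m ▷ X) *₋ (n ▷ Y)                                ≡⟨ *₋-linˡ (prefixBy X) m (n ▷ Y) ⟩
  lin (λ u → prefixBy X u *₋ (n ▷ Y)) m              ≈⟨ lin-fcong (λ u → *₋-linʳ (prefixBy Y) n (prefixBy X u)) m ⟩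
  bilin (λ u v → prefixBy X u *₋ prefixBy Y v) m n  ≈⟨ lin-fcong (λ u → lin-fcong (on-letters u) n) m ⟩
  bilin (λ u v → P₁ u v ++ (P₂ u v ++ P₃ u v)) m n  ≈⟨ ≋-trans (bilin-sum P₁ _ m n) (++-congʳ _ (bilin-sum P₂ P₃ m n)) ⟩
  bilin P₁ m n ++ (bilin P₂ m n ++ bilin P₃ m n)    ≈⟨ ++-cong first (++-cong second third) ⟩
  m ▷ (X *₋ (n ▷ Y)) ++ (n ▷ ((m ▷ X) *₋ Y) ++ (m ∘₋ n) ▷ (X *₋ Y)) ∎
  where
  open ≋-Reasoning
  P₁ P₂ P₃ : Word → Word → H
  P₁ u v = prefixBy (X *₋ prefixBy Y v) u
  P₂ u v = prefixBy (prefixBy X u *₋ Y) v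
  P₃ u v = firstLetters∘₋ u v ▷ (X *₋ Y)
  on-letters : ∀ u v → prefixBy X u *₋ prefixBy Y v ≋ P₁ u v ++ (P₂ u v ++ P₃ u v)
  on-letters [] [] = ≋-refl
  on-letters [] (b ∷ _) = ≋-refl
  on-letters (a ∷ _) [] = ≡⇒≋ (trans (lin-nil (z· a X)) (cong (λ z → z· a z ++ ([] ++ [])) (sym (lin-nil X))))
  on-letters (a ∷ _) (b ∷ _) = ≋-trans (*₋-z· a b X Y)
     (++-congʳ (z· a (X *₋ z· b Y)) (++-congʳ (z· b (z· a X *₋ Y)) (≡⇒≋ (sym (letter∘₋-▷ a b (X *₋ Y))))))
  first : bilin P₁ m n ≋ m ▷ (X *₋ (n ▷ Y))
  first = ≋-sym (lin-fcong on-words m)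
    where on-words : ∀ u → prefixBy (X *₋ (n ▷ Y)) u ≋ lin (P₁ u) n
          on-words [] = ≡⇒≋ (sym (lin-nil n))
          on-words (a ∷ _) = ≋-trans (z·-cong a (*₋-linʳ (prefixBy Y) n X)) (≡⇒≋ (sym (lin-z·F (λ v → X *₋ prefixBy Y v) a n)))
  second : bilin P₂ m n ≋ n ▷ ((m ▷ X) *₋ Y)
  second = ≋-trans (lin-swap P₂ m n) (≋-sym (lin-fcong on-words n))
    where on-words : ∀ v → prefixBy ((m ▷ X) *₋ Y) v ≋ lin (λ u → P₂ u v) m
          on-words [] = ≡⇒≋ (sym (lin-nil m))
          on-words (b ∷ _) = ≡⇒≋ (trans (cong (z· b) (*₋-linˡ (prefixBy X) m Y)) (sym (lin-z·F (λ u → prefixBy X u *₋ Y) b m)))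
  third : bilin P₃ m n ≋ (m ∘₋ n) ▷ (X *₋ Y)
  third = ≡⇒≋ (sym (trans (lin-comp (prefixBy (X *₋ Y)) (λ u → lin (firstLetters∘₋ u) n) m)
                          (lin-ext (λ u → lin-comp (prefixBy (X *₋ Y)) (firstLetters∘₋ u) n) m)))

z₁∘-letter∘₋ : ∀ a b → z₁∘ (letter∘₋ a b 𝟙) ≡ letter∘₋ (suc a) b 𝟙
z₁∘-letter∘₋ a b = trans (lin-++ (circ 0) (neg (word (s ∷ []))) (ħ· (word (t ∷ []))))
  (cong₂ _++_ (trans (lin-neg (circ 0) (word (s ∷ []))) (cong neg (lin-word (circ 0) (s ∷ []))))
              (trans (lin-ħ (circ 0) (word (t ∷ []))) (cong ħ· (lin-word (circ 0) (t ∷ [])))))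
  where s = suc (a ℕ.+ b)
        t = a ℕ.+ b

∘₋-z₁∘ˡ : ∀ m n → z₁∘ m ∘₋ n ≋ z₁∘ (m ∘₋ n)
∘₋-z₁∘ˡ m n = ≋-trans (≡⇒≋ (lin-comp (λ u → lin (firstLetters∘₋ u) n) (circ 0) m))
   (≋-trans (lin-fcong on-words m) (≡⇒≋ (sym (lin-comp (circ 0) (λ u → lin (firstLetters∘₋ u) n) m))))
  where
  on-words : ∀ u → lin (λ u' → lin (firstLetters∘₋ u') n) (circ 0 u) ≋ z₁∘ (lin (firstLetters∘₋ u) n)
  on-words [] = ≡⇒≋ (cong z₁∘ (sym (lin-nil n)))
  on-words (a ∷ w) = ≋-trans (≡⇒≋ (lin-word (λ u' → lin (firstLetters∘₋ u') n) (suc a ∷ w)))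
      (≋-trans (lin-fcong on-second n) (≡⇒≋ (sym (lin-comp (circ 0) (firstLetters∘₋ (a ∷ w)) n))))
    where on-second : ∀ v → firstLetters∘₋ (suc a ∷ w) v ≋ z₁∘ (firstLetters∘₋ (a ∷ w) v)
          on-second [] = ≋-refl
          on-second (b ∷ _) = ≡⇒≋ (sym (z₁∘-letter∘₋ a b))

∘₋-z₁∘ʳ : ∀ m n → m ∘₋ z₁∘ n ≋ z₁∘ (m ∘₋ n)
∘₋-z₁∘ʳ m n = ≋-trans (lin-fcong on-first m) (≡⇒≋ (sym (lin-comp (circ 0) (λ u → lin (firstLetters∘₋ u) n) m)))
  where
  on-words : ∀ u v → lin (firstLetters∘₋ u) (circ 0 v) ≋ z₁∘ (firstLetters∘₋ u v)
  on-words [] [] = ≋-refl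
  on-words (a ∷ _) [] = ≋-refl
  on-words [] (b ∷ w) = ≡⇒≋ (lin-word (firstLetters∘₋ []) (suc b ∷ w))
  on-words (a ∷ u) (b ∷ w) = ≡⇒≋ (trans (lin-word (firstLetters∘₋ (a ∷ u)) (suc b ∷ w))
      (trans (letter∘₋-by-sum {a} {suc b} {suc a} {b} {𝟙} (ℕP.+-suc a b)) (sym (z₁∘-letter∘₋ a b))))
  on-first : ∀ u → lin (firstLetters∘₋ u) (z₁∘ n) ≋ z₁∘ (lin (firstLetters∘₋ u) n)
  on-first u = ≋-trans (≡⇒≋ (lin-comp (firstLetters∘₋ u) (circ 0) n))
    (≋-trans (lin-fcong (on-words u) n) (≡⇒≋ (sym (lin-comp (circ 0) (firstLetters∘₋ u) n))))

-- ℓ_{c+1} = (z₁∘ − ħ) ℓ_c, and z₁∘ − ħ passes through ∘₋ on either side.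
z₁∘-ħ : H → H
z₁∘-ħ m = z₁∘ m ++ neg (ħ· m)

z₁∘-ħ-cong : ∀ {m n} → m ≋ n → z₁∘-ħ m ≋ z₁∘-ħ n
z₁∘-ħ-cong p = ++-cong (lin-cong (circ 0) p) (neg-cong (ħ-cong p))

z₁∘-ħ-neg : ∀ m → z₁∘-ħ (neg m) ≡ neg (z₁∘-ħ m)
z₁∘-ħ-neg m = trans (cong₂ _++_ (lin-neg (circ 0) m) (cong neg (sym (neg-ħ m)))) (sym (neg-++ (z₁∘ m) (neg (ħ· m))))

∘₋-z₁∘-ħˡ : ∀ m n → z₁∘-ħ m ∘₋ n ≋ z₁∘-ħ (m ∘₋ n)
∘₋-z₁∘-ħˡ m n = ≋-trans (≡⇒≋ (lin-++ F (z₁∘ m) (neg (ħ· m))))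
  (++-cong (∘₋-z₁∘ˡ m n) (≡⇒≋ (trans (lin-neg F (ħ· m)) (cong neg (lin-ħ F m)))))
  where F = λ u → lin (firstLetters∘₋ u) n

∘₋-z₁∘-ħʳ : ∀ m n → m ∘₋ z₁∘-ħ n ≋ z₁∘-ħ (m ∘₋ n)
∘₋-z₁∘-ħʳ m n = ≋-trans (lin-fcong (λ u → ≡⇒≋ (lin-++ (firstLetters∘₋ u) (z₁∘ n) (neg (ħ· n)))) m)
  (≋-trans (lin-sum (λ u → lin (firstLetters∘₋ u) (z₁∘ n)) (λ u → lin (firstLetters∘₋ u) (neg (ħ· n))) m)
   (++-cong (∘₋-z₁∘ʳ m n)
     (≡⇒≋ (trans (lin-ext (λ u → trans (lin-neg (firstLetters∘₋ u) (ħ· n)) (cong neg (lin-ħ (firstLetters∘₋ u) n))) m)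
                 (trans (lin-scaleF (λ u → ħ· (lin (firstLetters∘₋ u) n)) (- 1ℚ) 0 m)
                        (cong neg (lin-scaleF (λ u → lin (firstLetters∘₋ u) n) 1ℚ 1 m)))))))

-- ℓ_i ∘₋ ℓ_j = −ℓ_{i+j+1}: true for i = j = 0 by computation, and both sides
-- transform by z₁∘ − ħ when i or j increases.
ℓ-∘₋-ℓ : ∀ i j → ℓ i ∘₋ ℓ j ≋ neg (ℓ (suc (i ℕ.+ j)))
ℓ-∘₋-ℓ zero zero = ≋-sym (≡⇒≋ (trans (neg-++ (z₁∘ (ℓ 0)) (neg (ħ· (ℓ 0))))
                                     (cong (neg (word (1 ∷ [])) ++_) (neg-neg (ħ· (ℓ 0))))))
ℓ-∘₋-ℓ zero (suc j) = ≋-trans (∘₋-z₁∘-ħʳ (ℓ 0) (ℓ j))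
  (≋-trans (z₁∘-ħ-cong (ℓ-∘₋-ℓ zero j)) (≡⇒≋ (z₁∘-ħ-neg (ℓ (suc j)))))
ℓ-∘₋-ℓ (suc i) j = ≋-trans (∘₋-z₁∘-ħˡ (ℓ i) (ℓ j))
  (≋-trans (z₁∘-ħ-cong (ℓ-∘₋-ℓ i j)) (≡⇒≋ (z₁∘-ħ-neg (ℓ (suc (i ℕ.+ j))))))

σ-z· : ∀ i S → σ (z· i S) ≋ ℓ i ▷ σ S
σ-z· i S = ≋-trans (≡⇒≋ (lin-z· σw i S)) (≋-sym (▷-lin (ℓ i) σw S))

σw-*₋-σw : ∀ u v → σw u *₋ σw v ≋ σ (starbarw u v)
σw-*₋-σw [] v = ≡⇒≋ (trans (lin-word (λ u → lin (star₋w u) (σw v)) [])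
                           (trans (lin-word-id (σw v)) (sym (lin-word σw v))))
σw-*₋-σw (i ∷ u) [] = ≋-trans (lin-fcong *₋𝟙 (σw (i ∷ u)))
                              (≡⇒≋ (trans (lin-word-id (σw (i ∷ u))) (sym (lin-word σw (i ∷ u)))))
  where *₋𝟙 : ∀ u' → lin (star₋w u') 𝟙 ≋ word u'
        *₋𝟙 [] = ≡⇒≋ (lin-word (star₋w []) [])
        *₋𝟙 (k ∷ w) = ≡⇒≋ (lin-word (star₋w (k ∷ w)) [])
σw-*₋-σw (i ∷ u) (j ∷ v) = begin
  (ℓ i ▷ σw u) *₋ (ℓ j ▷ σw v)
    ≈⟨ ▷-rule (ℓ i) (ℓ j) (σw u) (σw v) ⟩
  ℓ i ▷ (σw u *₋ σw (j ∷ v)) ++ (ℓ j ▷ (σw (i ∷ u) *₋ σw v) ++ (ℓ i ∘₋ ℓ j) ▷ (σw u *₋ σw v))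
    ≈⟨ ++-cong (▷-cong {ℓ i} ≋-refl (σw-*₋-σw u (j ∷ v)))
               (++-cong (▷-cong {ℓ j} ≋-refl (σw-*₋-σw (i ∷ u) v)) (▷-cong (ℓ-∘₋-ℓ i j) (σw-*₋-σw u v))) ⟩
  ℓ i ▷ σ S₁ ++ (ℓ j ▷ σ S₂ ++ neg (ℓ s) ▷ σ S₃)
    ≡⟨ cong (λ z → ℓ i ▷ σ S₁ ++ (ℓ j ▷ σ S₂ ++ z)) (lin-neg (prefixBy (σ S₃)) (ℓ s)) ⟩
  ℓ i ▷ σ S₁ ++ (ℓ j ▷ σ S₂ ++ neg (ℓ s ▷ σ S₃))
    ≈⟨ ++-cong (≋-sym (σ-z· i S₁)) (++-cong (≋-sym (σ-z· j S₂)) (neg-cong (≋-sym (σ-z· s S₃)))) ⟩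
  σ (z· i S₁) ++ (σ (z· j S₂) ++ neg (σ (z· s S₃)))
    ≡⟨ sym (trans (lin-++ σw (z· i S₁) (z· j S₂ ++ neg (z· s S₃)))
                  (cong (σ (z· i S₁) ++_) (trans (lin-++ σw (z· j S₂) (neg (z· s S₃)))
                                                 (cong (σ (z· j S₂) ++_) (lin-neg σw (z· s S₃)))))) ⟩
  σ (starbarw (i ∷ u) (j ∷ v)) ∎
  where
  open ≋-Reasoning
  s = suc (i ℕ.+ j)
  S₁ = starbarw u (j ∷ v)
  S₂ = starbarw (i ∷ u) v
  S₃ = starbarw u v

σ-homomorphism : ∀ x y → σ x *₋ σ y ≋ σ (x ⊛ y)
σ-homomorphism x y = begin
  σ x *₋ σ y                                          ≡⟨ *₋-linˡ σw x (σ y) ⟩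
  lin (λ u → σw u *₋ σ y) x                            ≈⟨ lin-fcong (λ u → *₋-linʳ σw y (σw u)) x ⟩
  lin (λ u → lin (λ v → σw u *₋ σw v) y) x             ≈⟨ lin-fcong (λ u → lin-fcong (σw-*₋-σw u) y) x ⟩
  lin (λ u → lin (λ v → σ (starbarw u v)) y) x         ≡⟨ lin-ext (λ u → sym (lin-comp σw (starbarw u) y)) x ⟩
  lin (λ u → σ (lin (starbarw u) y)) x                 ≡⟨ sym (lin-comp σw (λ u → lin (starbarw u) y) x) ⟩
  σ (x ⊛ y)                                           ∎
  where open ≋-Reasoning

-- Proposition 4.5.  Ψ = σ needs only that dqinv is a right inverse of d_q.
proposition4p5 : (dqinv : H → H)
               → (∀ x → dq (dqinv x) ≈ x)
               → (∀ x → dqinv (dq x) ≈ x)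
               → ∀ (w₁ w₂ : H) → Ψ dqinv w₁ *₋ Ψ dqinv w₂ ≈ Ψ dqinv (w₁ ⊛ w₂)
proposition4p5 dqinv dq∘dqinv≈id _ w₁ w₂ = get (begin
  Ψ dqinv w₁ *₋ Ψ dqinv w₂   ≈⟨ bilin-cong star₋w (Ψ≋σ dqinv dq∘dqinv≈id w₁) (Ψ≋σ dqinv dq∘dqinv≈id w₂) ⟩
  σ w₁ *₋ σ w₂               ≈⟨ σ-homomorphism w₁ w₂ ⟩
  σ (w₁ ⊛ w₂)                ≈⟨ ≋-sym (Ψ≋σ dqinv dq∘dqinv≈id (w₁ ⊛ w₂)) ⟩
  Ψ dqinv (w₁ ⊛ w₂)          ∎)
  where open ≋-Reasoning
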